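{- Let $\Pi$ be a recogniser, recogniser$_{\geqslant 1}$ or acknowledger membrane system (active membranes without charges and without dissolution). Let $\mathcal{C}_i$ be a configuration of $\Pi$ containing an instance of an object $o$ in a membrane with label $h$, and let $\mathcal{C}^{\emptyset}_i$ be obtained from $\mathcal{C}_i$ by removing all objects other than this instance of $o$. If starting from $\mathcal{C}^{\emptyset}_i$ there is a computation that halts after $t$ steps on a configuration containing the object $\texttt{yes}$ in the environment membrane, then starting from $\mathcal{C}_i$ there exists a halting computation that has $\texttt{yes}$ in the environment membrane.
   Context: An active membrane system without charges and without dissolution is a tuple $\Pi=(O,\mu,M,H,\Lambda,R)$: $O$ a finite object alphabet; $\mu=(V_\mu,E_\mu,env)$ a finite rooted tree of membranes with root $env$ (the environment); $M$ gives each membrane a finite multiset of objects; $\Lambda:V_\mu\to H$ gives labels (initially injective; the root is labelled $env$); $R$ a finite set of rules of types (a) $[o\to w]_h$ (rewrite $o$ in a membrane labelled $h$ into multiset $w$), (b) $o[\,]_h\to[u]_h$ (move $o$ into a child labelled $h$, becoming $u$), (c) $[o]_h\to[\,]_h u$ (move $o$ out of a membrane labelled $h$ to its parent, becoming $u$), (e) $[o]_h\to[u]_h[v]_h$ (divide an elementary membrane labelled $h$ containing $o$, $o$ becoming $u$ in one copy and $v$ in the other). The environment cannot divide or send objects out. Each step applies a non-deterministically chosen maximal multiset of applicable rules, where each object takes part in at most one rule, each membrane is subject of at most one rule of type (b), (c), (e), innermost membranes are processed first, and type (a) rules in a dividing membrane are applied before the division. A computation is a sequence of configurations each obtained from the previous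 by a step; it halts when no rule is applicable. The object set contains special objects $\texttt{yes}$ and $\texttt{no}$ to which no rules apply. A recogniser system: all computations halt and at the halting step (and not before) exactly one of $\texttt{yes}$, $\texttt{no}$ appears in the environment. A recogniser$_{\geqslant 1}$ system: all computations halt and in the environment either one or more copies of $\texttt{yes}$, or one or more copies of $\texttt{no}$ appear, but not both. An acknowledger system: all computations halt (copies of $\texttt{yes}$ may or may not appear in the environment). -}

module Defs where

open import Data.Nat using (ℕ; zero; suc; _+_; _∸_; _≤_)
open import Data.Fin using (Fin; _≟_)
open import Data.Vec using (Vec; replicate; zipWith; tabulate; lookup)
open import Data.List using (List; []; _∷_; map; _++_)
open import Data.Nat.ListAction using (sum)
open import Data.List.Membership.Propositional using (_∈_)
open import Data.List.Relation.Unary.All using (All)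
open import Data.List.Relation.Unary.Unique.Propositional using (Unique)
open import Data.Maybe using (Maybe; just; nothing)
open import Data.Product using (Σ; _×_; _,_)
open import Data.Sum using (_⊎_)
open import Data.Bool using (Bool; true; false; if_then_else_)
open import Data.Unit using (⊤)
open import Data.Empty using (⊥)
open import Relation.Nullary using (¬_)
open import Relation.Nullary.Decidable using (⌊_⌋)
open import Relation.Binary.PropositionalEquality using (_≡_; _≢_)
open import Induction.WellFounded using (Acc)

Multiset : ℕ → Set
Multiset n = Vec ℕ n

∅ₘ : ∀ {n} → Multiset n
∅ₘ {n} = replicate n 0

_⊕_ : ∀ {n} → Multiset n → Multiset n → Multiset n
_⊕_ = zipWith _+_

_⊖_ : ∀ {n} → Multiset n → Multiset n → Multiset n
_⊖_ = zipWith _∸_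

single : ∀ {n} → Fin n → Multiset n
single o = tabulate (λ j → if ⌊ j ≟ o ⌋ then 1 else 0)

Σₘ : ∀ {n} → List (Multiset n) → Multiset n
Σₘ [] = ∅ₘ
Σₘ (x ∷ xs) = x ⊕ Σₘ xs

_⊆ₘ_ : ∀ {n} → Multiset n → Multiset n → Set
u ⊆ₘ v = ∀ j → lookup u j ≤ lookup v j

data Rule (nO nH : ℕ) : Set where
  -- (a) [o → w]_h
  evo  : (h : Fin nH) (o : Fin nO) (w : Multiset nO) → Rule nO nH
  -- (b) o [ ]_h → [u]_h
  into : (h : Fin nH) (o u : Fin nO) → Rule nO nH
  -- (c) [o]_h → [ ]_h u
  out  : (h : Fin nH) (o u : Fin nO) → Rule nO nH
  -- (e) [o]_h → [u]_h [v]_h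
  div  : (h : Fin nH) (o u v : Fin nO) → Rule nO nH

module _ {nO nH : ℕ} where

  ruleLabel : Rule nO nH → Fin nH
  ruleLabel (evo h _ _) = h
  ruleLabel (into h _ _) = h
  ruleLabel (out h _ _) = h
  ruleLabel (div h _ _ _) = h

  ruleLhs : Rule nO nH → Fin nO
  ruleLhs (evo _ o _) = o
  ruleLhs (into _ o _) = o
  ruleLhs (out _ o _) = o
  ruleLhs (div _ o _ _) = o

  lhsLocal : Rule nO nH → Multiset nO
  lhsLocal (into _ _ _) = ∅ₘ
  lhsLocal r = single (ruleLhs r)

  -- object consumed from the parent (type (b) rules)
  lhsParent : Rule nO nH → Multiset nO
  lhsParent (into _ o _) = single o
  lhsParent _ = ∅ₘ

  rhsA : Rule nO nH → Multiset nO
  rhsA (evo _ _ w) = w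
  rhsA _ = ∅ₘ

  rhsIn : Rule nO nH → Multiset nO
  rhsIn (into _ _ u) = single u
  rhsIn _ = ∅ₘ

  -- products of (c) rules (appear in the parent)
  rhsOut : Rule nO nH → Multiset nO
  rhsOut (out _ _ u) = single u
  rhsOut _ = ∅ₘ

  -- 1 for rules of type (b), (c), (e) (the membrane is their subject)
  memRule : Rule nO nH → ℕ
  memRule (evo _ _ _) = 0
  memRule _ = 1

  IsEvo : Rule nO nH → Set
  IsEvo (evo _ _ _) = ⊤
  IsEvo _ = ⊥

  IsDiv : Rule nO nH → Set
  IsDiv (div _ _ _ _) = ⊤
  IsDiv _ = ⊥

  divOf : List (Rule nO nH) → Maybe (Fin nO × Fin nO)
  divOf [] = nothing
  divOf (div _ _ u v ∷ rs) = just (u , v)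
  divOf (_ ∷ rs) = divOf rs

-- Configurations: rooted trees of labelled membranes with multisets.
-- The root is the environment.

data Mem (nO nH : ℕ) : Set where
  mem : Fin nH → Multiset nO → List (Mem nO nH) → Mem nO nH

-- Membrane trees annotated with the multiset of rules applied at each
-- membrane (rules of type (b) are located at the target child membrane).
data ATree (nO nH : ℕ) : Set where
  anode : Fin nH → Multiset nO → List (Rule nO nH) → List (ATree nO nH) → ATree nO nH

module _ {nO nH : ℕ} where

  labelOf : Mem nO nH → Fin nH
  labelOf (mem h _ _) = h

  envContent : Mem nO nH → Multiset nO
  envContent (mem _ m _) = m

  mutual
    labels : Mem nO nH → List (Fin nH)
    labels (mem h _ cs) = h ∷ labelsL cs

    labelsL : List (Mem nO nH) → List (Fin nH)
    labelsL [] = []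
    labelsL (c ∷ cs) = labels c ++ labelsL cs

  mutual
    erase : ATree nO nH → Mem nO nH
    erase (anode h m _ cs) = mem h m (eraseL cs)

    eraseL : List (ATree nO nH) → List (Mem nO nH)
    eraseL [] = []
    eraseL (c ∷ cs) = erase c ∷ eraseL cs

  mutual
    bare : Mem nO nH → ATree nO nH
    bare (mem h m cs) = anode h m [] (bareL cs)

    bareL : List (Mem nO nH) → List (ATree nO nH)
    bareL [] = []
    bareL (c ∷ cs) = bare c ∷ bareL cs

  mutual
    ruleCount : ATree nO nH → ℕ
    ruleCount (anode _ _ rs cs) = Data.List.length rs + ruleCountL cs

    ruleCountL : List (ATree nO nH) → ℕ
    ruleCountL [] = 0
    ruleCountL (c ∷ cs) = ruleCount c + ruleCountL cs

  rulesOf : ATree nO nH → List (Rule nO nH)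
  rulesOf (anode _ _ rs _) = rs

  childConsumption : List (ATree nO nH) → Multiset nO
  childConsumption cs = Σₘ (map (λ c → Σₘ (map lhsParent (rulesOf c))) cs)

  childProduction : List (ATree nO nH) → Multiset nO
  childProduction cs = Σₘ (map (λ c → Σₘ (map rhsOut (rulesOf c))) cs)

  consumed : List (Rule nO nH) → List (ATree nO nH) → Multiset nO
  consumed rs cs = Σₘ (map lhsLocal rs) ⊕ childConsumption cs

  -- restriction on communication/division rules: the environment (root)
  -- only uses (a) rules; any other membrane is the subject of at most
  -- one rule of type (b), (c), (e).
  SubjectCond : Bool → List (Rule nO nH) → Set
  SubjectCond true rs = All IsEvo rs
  SubjectCond false rs = sum (map memRule rs) ≤ 1

  -- validity of a multiset of rule applications (the Bool says whether the
  -- node is the root / environment)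
  mutual
    Valid : List (Rule nO nH) → Bool → ATree nO nH → Set
    Valid R root (anode h m rs cs) =
      All (_∈ R) rs ×
      All (λ r → ruleLabel r ≡ h) rs ×
      SubjectCond root rs ×
      All (λ r → IsDiv r → cs ≡ []) rs ×
      consumed rs cs ⊆ₘ m ×
      ValidL R cs

    ValidL : List (Rule nO nH) → List (ATree nO nH) → Set
    ValidL R [] = ⊤
    ValidL R (c ∷ cs) = Valid R false c × ValidL R cs

  mutual
    data _⊏_ : ATree nO nH → ATree nO nH → Set where
      here  : ∀ {h m rs cs} (r : Rule nO nH) →
              anode h m rs cs ⊏ anode h m (r ∷ rs) cs
      there : ∀ {h m rs cs cs'} → cs ⊏ₗ cs' →
              anode h m rs cs ⊏ anode h m rs cs'

    data _⊏ₗ_ : List (ATree nO nH) → List (ATree nO nH) → Set where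
      hd : ∀ {c c' cs} → c ⊏ c' → (c ∷ cs) ⊏ₗ (c' ∷ cs)
      tl : ∀ {c cs cs'} → cs ⊏ₗ cs' → (c ∷ cs) ⊏ₗ (c ∷ cs')

  Maximal : List (Rule nO nH) → ATree nO nH → Set
  Maximal R T = ∀ T' → T ⊏ T' → ¬ Valid R true T'

  mkNodes : Fin nH → Multiset nO → List (Mem nO nH) →
            Maybe (Fin nO × Fin nO) → List (Mem nO nH)
  mkNodes h base cs' nothing = mem h base cs' ∷ []
  mkNodes h base cs' (just (u , v)) =
    mem h (base ⊕ single u) cs' ∷ mem h (base ⊕ single v) cs' ∷ []

  -- result of applying the annotated rules; a dividing membrane yields two
  -- copies (products of (a) rules are present in both copies)
  mutual
    result : ATree nO nH → List (Mem nO nH)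
    result (anode h m rs cs) =
      mkNodes h
        ((((m ⊖ consumed rs cs) ⊕ Σₘ (map rhsA rs)) ⊕ childProduction cs)
           ⊕ Σₘ (map rhsIn rs))
        (resultL cs) (divOf rs)

    resultL : List (ATree nO nH) → List (Mem nO nH)
    resultL [] = []
    resultL (c ∷ cs) = result c ++ resultL cs

  Step : List (Rule nO nH) → Mem nO nH → Mem nO nH → Set
  Step R C C' = Σ (ATree nO nH) λ T →
    erase T ≡ C × Valid R true T × Maximal R T × 1 ≤ ruleCount T ×
    result T ≡ C' ∷ []

  -- halting: no rule is applicable
  Halted : List (Rule nO nH) → Mem nO nH → Set
  Halted R C = Maximal R (bare C)

  data Reach (R : List (Rule nO nH)) : Mem nO nH → ℕ → Mem nO nH → Set where
    done : ∀ {C} → Reach R C 0 C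
    step : ∀ {C C₁ C₂ t} → Step R C C₁ → Reach R C₁ t C₂ → Reach R C (suc t) C₂

  -- all computations from C halt (no infinite computation), constructively
  AllHalt : List (Rule nO nH) → Mem nO nH → Set
  AllHalt R = Acc (λ C' C → Step R C C')

  -- Positions: paths of child indices from the root
  mutual
    nodeAt : Mem nO nH → List ℕ → Maybe (Fin nH × Multiset nO)
    nodeAt (mem h m cs) [] = just (h , m)
    nodeAt (mem h m cs) (k ∷ p) = nodeAtL cs k p

    nodeAtL : List (Mem nO nH) → ℕ → List ℕ → Maybe (Fin nH × Multiset nO)
    nodeAtL [] k p = nothing
    nodeAtL (c ∷ cs) zero p = nodeAt c p
    nodeAtL (c ∷ cs) (suc k) p = nodeAtL cs k p

  mutual
    clear : Mem nO nH → Mem nO nH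
    clear (mem h m cs) = mem h ∅ₘ (clearL cs)

    clearL : List (Mem nO nH) → List (Mem nO nH)
    clearL [] = []
    clearL (c ∷ cs) = clear c ∷ clearL cs

  mutual
    isolate : Mem nO nH → List ℕ → Fin nO → Mem nO nH
    isolate (mem h m cs) [] o = mem h (single o) (clearL cs)
    isolate (mem h m cs) (k ∷ p) o = mem h ∅ₘ (isolateL cs k p o)

    isolateL : List (Mem nO nH) → ℕ → List ℕ → Fin nO → List (Mem nO nH)
    isolateL [] k p o = []
    isolateL (c ∷ cs) zero p o = isolate c p o ∷ clearL cs
    isolateL (c ∷ cs) (suc k) p o = clear c ∷ isolateL cs k p o

record System (nO nH : ℕ) : Set where
  field
    yes no     : Fin nO
    yes≢no     : yes ≢ no
    env        : Fin nH
    rules      : List (Rule nO nH)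
    initial    : Mem nO nH
    initialEnv : labelOf initial ≡ env
    initialInj : Unique (labels initial)
    noRuleYes  : All (λ r → ruleLhs r ≢ yes) rules
    noRuleNo   : All (λ r → ruleLhs r ≢ no) rules

module _ {nO nH : ℕ} (Π : System nO nH) where
  open System Π

  countEnv : Mem nO nH → Fin nO → ℕ
  countEnv C o = lookup (envContent C) o

  IsAcknowledger : Set
  IsAcknowledger = AllHalt rules initial

  IsRecogniser : Set
  IsRecogniser = AllHalt rules initial ×
    (∀ t C → Reach rules initial t C →
      (Halted rules C → countEnv C yes + countEnv C no ≡ 1) ×
      (¬ Halted rules C → countEnv C yes ≡ 0 × countEnv C no ≡ 0))

  IsRecogniser≥1 : Set
  IsRecogniser≥1 = AllHalt rules initial ×
    (∀ t C → Reach rules initial t C → Halted rules C →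
      (1 ≤ countEnv C yes × countEnv C no ≡ 0) ⊎
      (1 ≤ countEnv C no × countEnv C yes ≡ 0))

module Submission where

-- Since labels are initially unique and membranes never dissolve, every reachable
-- configuration has the label tree of the initial one, up to the number of copies of
-- each membrane (module Shape).  On this fixed tree we define inductively when an
-- object x in a membrane labelled h is Productive: some rule applicable to x yields an
-- object that is productive where it lands, ending with yes in the environment.
--  * Backward (Productivity.trace-run): tracing the yes of the computation from C^∅
--    back step by step, every object of a step's result stems from an object or rule
--    of the previous configuration, so C^∅ contains a productive object; it can only
--    be o at h.
--  * Forward (Forward.forward): in Cᵢ, apply the first rule of the productivity
--    derivation to the copy of o, complete it to a maximal step (valid annotations
--    always extend to maximal ones, as rules consume objects) and continue from its
--    product; once yes is in the environment it is never consumed, and since all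
--    computations halt, continuing arbitrarily yields a halting computation.

open import Defs

open import Data.Nat using (ℕ; zero; suc; _+_; _∸_; _≤_; z≤n; s≤s)
open import Data.Nat.Properties
  using (≤-refl; ≤-trans; ≤-reflexive; m≤m+n; m≤n+m; m∸n≤m; +-mono-≤; +-monoˡ-≤; +-commutativeSemigroup;
         module ≤-Reasoning)
import Data.Nat.Properties as ℕₚ
open import Data.Nat.ListAction using (sum)
open import Data.Nat.Tactic.RingSolver using (solve-∀)
open import Algebra.Properties.CommutativeSemigroup +-commutativeSemigroup
  using () renaming (interchange to +-interchange)
open import Data.Fin using (Fin; _≟_) renaming (zero to fzero; suc to fsuc)
import Data.Fin.Properties as Finₚ
open import Data.Vec using ([]; _∷_; lookup)
import Data.Vec
open import Data.Vec.Properties using (lookup-zipWith; lookup-replicate; lookup∘tabulate; ≡-dec)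
open import Data.List using (List; []; _∷_; map; length; _++_)
open import Data.List.Membership.Propositional using (_∈_; _∉_; find; lose)
open import Data.List.Membership.Propositional.Properties using (∈-map⁺; ∈-map⁻; ∈-++⁺ˡ; ∈-++⁺ʳ; ∈-++⁻)
import Data.List.Membership.DecPropositional
open import Data.List.Relation.Unary.All using (All; []; _∷_)
import Data.List.Relation.Unary.All as All
open import Data.List.Relation.Unary.Any using (here; there; any?)
open import Data.List.Relation.Unary.AllPairs using ([]; _∷_)
open import Data.List.Relation.Unary.Unique.Propositional using (Unique)
open import Data.Product using (Σ; _×_; _,_; proj₁; proj₂)
open import Data.Sum using (_⊎_; inj₁; inj₂)
open import Data.Maybe using (nothing; just)
open import Data.Bool using (Bool; true; false; if_then_else_)
open import Data.Unit using (⊤; tt)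
open import Data.Empty using (⊥; ⊥-elim)
open import Induction.WellFounded using (acc)
open import Relation.Binary using (DecidableEquality)
open import Relation.Binary.Construct.Closure.ReflexiveTransitive using (Star; ε; _◅_)
open import Relation.Binary.PropositionalEquality
open import Relation.Nullary using (¬_; Dec; yes; no)
open import Relation.Nullary.Decidable using (⌊_⌋; map′; _×-dec_; _→-dec_)
open import Relation.Unary using (Decidable)

module _ {n : ℕ} where

  infix 4 _∈ₘ_
  _∈ₘ_ : Fin n → Multiset n → Set
  j ∈ₘ u = 1 ≤ lookup u j

  lookup-⊕ : ∀ (u v : Multiset n) j → lookup (u ⊕ v) j ≡ lookup u j + lookup v j
  lookup-⊕ u v j = lookup-zipWith _+_ j u v

  lookup-⊖ : ∀ (u v : Multiset n) j → lookup (u ⊖ v) j ≡ lookup u j ∸ lookup v j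
  lookup-⊖ u v j = lookup-zipWith _∸_ j u v

  lookup-∅ : ∀ (j : Fin n) → lookup (∅ₘ {n}) j ≡ 0
  lookup-∅ j = lookup-replicate j 0

  lookup-single : ∀ (o j : Fin n) → lookup (single o) j ≡ (if ⌊ j ≟ o ⌋ then 1 else 0)
  lookup-single o j = lookup∘tabulate (λ i → if ⌊ i ≟ o ⌋ then 1 else 0) j

  lookup-⊕-zeroˡ : ∀ (u v : Multiset n) j → lookup u j ≡ 0 → lookup (u ⊕ v) j ≡ lookup v j
  lookup-⊕-zeroˡ u v j u≡0 = trans (lookup-⊕ u v j) (cong (_+ lookup v j) u≡0)

  lookup-⊕-zeroʳ : ∀ (u v : Multiset n) j → lookup v j ≡ 0 → lookup (u ⊕ v) j ≡ lookup u j
  lookup-⊕-zeroʳ u v j v≡0 = trans (lookup-⊕ u v j) (trans (cong (lookup u j +_) v≡0) (ℕₚ.+-identityʳ _))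

  ∉ₘ-∅ : ∀ (j : Fin n) → ¬ (j ∈ₘ ∅ₘ)
  ∉ₘ-∅ j p rewrite lookup-∅ j with p
  ... | ()

  ∈ₘ-single : ∀ (o : Fin n) → o ∈ₘ single o
  ∈ₘ-single o with o ≟ o | lookup-single o o
  ... | yes _ | e = subst (1 ≤_) (sym e) ≤-refl
  ... | no o≢o | _ = ⊥-elim (o≢o refl)

  ∈ₘ-single⁻ : ∀ (o j : Fin n) → j ∈ₘ single o → j ≡ o
  ∈ₘ-single⁻ o j p with j ≟ o | subst (1 ≤_) (lookup-single o j) p
  ... | yes j≡o | _ = j≡o
  ... | no _ | ()

  ⊆ₘ-refl : ∀ {u : Multiset n} → u ⊆ₘ u
  ⊆ₘ-refl j = ≤-refl

  ∅-⊆ₘ : ∀ (u : Multiset n) → ∅ₘ ⊆ₘ u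
  ∅-⊆ₘ u j = subst (_≤ lookup u j) (sym (lookup-∅ j)) z≤n

  ⊆ₘ-⊕ˡ : ∀ (u v : Multiset n) → u ⊆ₘ (u ⊕ v)
  ⊆ₘ-⊕ˡ u v j = subst (lookup u j ≤_) (sym (lookup-⊕ u v j)) (m≤m+n _ _)

  ⊆ₘ-⊕ʳ : ∀ (u v : Multiset n) → v ⊆ₘ (u ⊕ v)
  ⊆ₘ-⊕ʳ u v j = subst (lookup v j ≤_) (sym (lookup-⊕ u v j)) (m≤n+m _ _)

  single-⊆ₘ : ∀ (u : Multiset n) {o} → o ∈ₘ u → single o ⊆ₘ u
  single-⊆ₘ u {o} p j with j ≟ o | lookup-single o j
  ... | yes refl | e = subst (_≤ lookup u o) (sym e) p
  ... | no _ | e = subst (_≤ lookup u j) (sym e) z≤n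

  ∈ₘ-⊕⁻ : ∀ (u v : Multiset n) {j} → j ∈ₘ u ⊕ v → j ∈ₘ u ⊎ j ∈ₘ v
  ∈ₘ-⊕⁻ u v {j} p with lookup u j | lookup-⊕ u v j
  ... | zero  | e = inj₂ (subst (1 ≤_) e p)
  ... | suc _ | _ = inj₁ (s≤s z≤n)

  ∈ₘ-⊖⁻ : ∀ (u v : Multiset n) {j} → j ∈ₘ u ⊖ v → j ∈ₘ u
  ∈ₘ-⊖⁻ u v {j} p = ≤-trans (subst (1 ≤_) (lookup-⊖ u v j) p) (m∸n≤m (lookup u j) (lookup v j))

  ∈ₘ-⊖⁺ : ∀ (u v : Multiset n) {j} → j ∈ₘ u → ¬ (j ∈ₘ v) → j ∈ₘ u ⊖ v
  ∈ₘ-⊖⁺ u v {j} p j∉v with lookup v j in e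
  ... | suc _ = ⊥-elim (j∉v (s≤s z≤n))
  ... | zero = subst (1 ≤_) (sym (trans (lookup-⊖ u v j) (cong (lookup u j ∸_) e))) p

module _ {A : Set} {n : ℕ} (f : A → Multiset n) where

  ⊆ₘ-Σₘ : ∀ {x} xs → x ∈ xs → f x ⊆ₘ Σₘ (map f xs)
  ⊆ₘ-Σₘ (x ∷ xs) (here refl) = ⊆ₘ-⊕ˡ (f x) _
  ⊆ₘ-Σₘ (y ∷ xs) (there x∈xs) j = ≤-trans (⊆ₘ-Σₘ xs x∈xs j) (⊆ₘ-⊕ʳ (f y) (Σₘ (map f xs)) j)

  Σₘ-single : ∀ x j → lookup (Σₘ (map f (x ∷ []))) j ≡ lookup (f x) j
  Σₘ-single x j = lookup-⊕-zeroʳ (f x) ∅ₘ j (lookup-∅ j)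

  ∈ₘ-Σₘ⁻ : ∀ xs {j} → j ∈ₘ Σₘ (map f xs) → Σ A λ x → x ∈ xs × j ∈ₘ f x
  ∈ₘ-Σₘ⁻ [] {j} p = ⊥-elim (∉ₘ-∅ j p)
  ∈ₘ-Σₘ⁻ (x ∷ xs) p with ∈ₘ-⊕⁻ (f x) _ p
  ... | inj₁ q = x , here refl , q
  ... | inj₂ q with ∈ₘ-Σₘ⁻ xs q
  ...   | y , y∈xs , r = y , there y∈xs , r

size : ∀ {n} → Multiset n → ℕ
size = Data.Vec.sum

size-⊕ : ∀ {n} (u v : Multiset n) → size (u ⊕ v) ≡ size u + size v
size-⊕ [] [] = refl
size-⊕ (a ∷ u) (b ∷ v) = trans (cong (a + b +_) (size-⊕ u v)) (+-interchange a b (size u) (size v))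

size-∅ : ∀ {n} → size (∅ₘ {n}) ≡ 0
size-∅ {zero} = refl
size-∅ {suc n} = size-∅ {n}

size-mono : ∀ {n} {u v : Multiset n} → u ⊆ₘ v → size u ≤ size v
size-mono {u = []} {[]} _ = z≤n
size-mono {u = a ∷ u} {b ∷ v} u⊆v = +-mono-≤ (u⊆v fzero) (size-mono {u = u} {v} (λ j → u⊆v (fsuc j)))

lookup≤size : ∀ {n} (u : Multiset n) j → lookup u j ≤ size u
lookup≤size (a ∷ u) fzero = m≤m+n a (size u)
lookup≤size (a ∷ u) (fsuc j) = ≤-trans (lookup≤size u j) (m≤n+m (size u) a)

size-single : ∀ {n} (o : Fin n) → 1 ≤ size (single o)
size-single o = ≤-trans (∈ₘ-single o) (lookup≤size (single o) o)

validL-∈ : ∀ {nO nH} {R : List (Rule nO nH)} {c} cs → ValidL R cs → c ∈ cs → Valid R false c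
validL-∈ (c ∷ cs) (v , _) (here refl) = v
validL-∈ (c ∷ cs) (_ , vs) (there c∈cs) = validL-∈ cs vs c∈cs

-- Every rule application consumes an object, so a valid annotation applies at
-- most as many rules as there are objects available to it.

module _ {nO nH : ℕ} where

  mutual
    objects : ATree nO nH → ℕ
    objects (anode _ m _ cs) = size m + objectsL cs

    objectsL : List (ATree nO nH) → ℕ
    objectsL [] = 0
    objectsL (c ∷ cs) = objects c + objectsL cs

  demand : ATree nO nH → ℕ
  demand T = size (Σₘ (map lhsParent (rulesOf T)))

  lhs-size : ∀ (r : Rule nO nH) → 1 ≤ size (lhsLocal r) + size (lhsParent r)
  lhs-size (evo _ o _) = ≤-trans (size-single o) (m≤m+n _ _)
  lhs-size (into _ o _) = ≤-trans (size-single o) (m≤n+m _ (size (∅ₘ {nO})))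
  lhs-size (out _ o _) = ≤-trans (size-single o) (m≤m+n _ _)
  lhs-size (div _ o _ _) = ≤-trans (size-single o) (m≤m+n _ _)

  length≤consumption : ∀ (rs : List (Rule nO nH)) →
    length rs ≤ size (Σₘ (map lhsLocal rs)) + size (Σₘ (map lhsParent rs))
  length≤consumption [] = z≤n
  length≤consumption (r ∷ rs) = begin
    1 + length rs
      ≤⟨ +-mono-≤ (lhs-size r) (length≤consumption rs) ⟩
    (size (lhsLocal r) + size (lhsParent r)) + (size (Σₘ (map lhsLocal rs)) + size (Σₘ (map lhsParent rs)))
      ≡⟨ +-interchange (size (lhsLocal r)) _ _ _ ⟩
    (size (lhsLocal r) + size (Σₘ (map lhsLocal rs))) + (size (lhsParent r) + size (Σₘ (map lhsParent rs)))
      ≡⟨ sym (cong₂ _+_ (size-⊕ (lhsLocal r) _) (size-⊕ (lhsParent r) _)) ⟩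
    size (Σₘ (map lhsLocal (r ∷ rs))) + size (Σₘ (map lhsParent (r ∷ rs))) ∎
    where open ≤-Reasoning

  size-childConsumption : ∀ (cs : List (ATree nO nH)) → size (childConsumption cs) ≡ sum (map demand cs)
  size-childConsumption [] = size-∅ {nO}
  size-childConsumption (c ∷ cs) =
    trans (size-⊕ (Σₘ (map lhsParent (rulesOf c))) _) (cong (demand c +_) (size-childConsumption cs))

  mutual
    ruleCount-bound : ∀ {R b} (T : ATree nO nH) → Valid R b T → ruleCount T ≤ objects T + demand T
    ruleCount-bound {R} (anode h m rs cs) (_ , _ , _ , _ , available , vcs) = begin
      length rs + ruleCountL cs
        ≤⟨ +-mono-≤ (length≤consumption rs) (ruleCountL-bound cs vcs) ⟩
      (local + fromParent) + (objectsL cs + sum (map demand cs))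
        ≡⟨ reorder local fromParent (objectsL cs) (sum (map demand cs)) ⟩
      (local + sum (map demand cs)) + objectsL cs + fromParent
        ≡⟨ cong (λ k → local + k + objectsL cs + fromParent) (sym (size-childConsumption cs)) ⟩
      (local + size (childConsumption cs)) + objectsL cs + fromParent
        ≡⟨ cong (λ k → k + objectsL cs + fromParent) (sym (size-⊕ (Σₘ (map lhsLocal rs)) _)) ⟩
      size (consumed rs cs) + objectsL cs + fromParent
        ≤⟨ +-monoˡ-≤ fromParent (+-monoˡ-≤ (objectsL cs) (size-mono {u = consumed rs cs} {m} available)) ⟩
      size m + objectsL cs + fromParent ∎
      where
      open ≤-Reasoning
      local : ℕ
      local = size (Σₘ (map lhsLocal rs))
      fromParent : ℕ
      fromParent = size (Σₘ (map lhsParent rs))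
      reorder : ∀ a b c d → a + b + (c + d) ≡ a + d + c + b
      reorder = solve-∀

    ruleCountL-bound : ∀ {R} (cs : List (ATree nO nH)) → ValidL R cs → ruleCountL cs ≤ objectsL cs + sum (map demand cs)
    ruleCountL-bound [] _ = z≤n
    ruleCountL-bound (c ∷ cs) (v , vs) = begin
      ruleCount c + ruleCountL cs
        ≤⟨ +-mono-≤ (ruleCount-bound c v) (ruleCountL-bound cs vs) ⟩
      (objects c + demand c) + (objectsL cs + sum (map demand cs))
        ≡⟨ +-interchange (objects c) _ _ _ ⟩
      (objects c + objectsL cs) + (demand c + sum (map demand cs)) ∎
      where open ≤-Reasoning

  -- the environment applies only rules of type (a), which take nothing from a parent
  demand-root : ∀ {R} (T : ATree nO nH) → Valid R true T → demand T ≡ 0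
  demand-root (anode _ _ rs _) (_ , _ , evos , _) = go rs evos
    where
    go : ∀ (rs : List (Rule nO nH)) → All IsEvo rs → size (Σₘ (map lhsParent rs)) ≡ 0
    go [] _ = size-∅ {nO}
    go (evo _ _ _ ∷ rs) (_ ∷ evos) = trans (size-⊕ (∅ₘ {nO}) _) (cong₂ _+_ (size-∅ {nO}) (go rs evos))

module _ {nO nH : ℕ} where

  _≟ʳ_ : DecidableEquality (Rule nO nH)
  evo h o w ≟ʳ evo h' o' w' = map′ (λ { (refl , refl , refl) → refl }) (λ { refl → refl , refl , refl })
    (h ≟ h' ×-dec o ≟ o' ×-dec ≡-dec ℕₚ._≟_ w w')
  into h o u ≟ʳ into h' o' u' = map′ (λ { (refl , refl , refl) → refl }) (λ { refl → refl , refl , refl })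
    (h ≟ h' ×-dec o ≟ o' ×-dec u ≟ u')
  out h o u ≟ʳ out h' o' u' = map′ (λ { (refl , refl , refl) → refl }) (λ { refl → refl , refl , refl })
    (h ≟ h' ×-dec o ≟ o' ×-dec u ≟ u')
  div h o u v ≟ʳ div h' o' u' v' = map′ (λ { (refl , refl , refl , refl) → refl }) (λ { refl → refl , refl , refl , refl })
    (h ≟ h' ×-dec o ≟ o' ×-dec u ≟ u' ×-dec v ≟ v')
  evo _ _ _ ≟ʳ into _ _ _ = no λ ()
  evo _ _ _ ≟ʳ out _ _ _ = no λ ()
  evo _ _ _ ≟ʳ div _ _ _ _ = no λ ()
  into _ _ _ ≟ʳ evo _ _ _ = no λ ()
  into _ _ _ ≟ʳ out _ _ _ = no λ ()
  into _ _ _ ≟ʳ div _ _ _ _ = no λ ()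
  out _ _ _ ≟ʳ evo _ _ _ = no λ ()
  out _ _ _ ≟ʳ into _ _ _ = no λ ()
  out _ _ _ ≟ʳ div _ _ _ _ = no λ ()
  div _ _ _ _ ≟ʳ evo _ _ _ = no λ ()
  div _ _ _ _ ≟ʳ into _ _ _ = no λ ()
  div _ _ _ _ ≟ʳ out _ _ _ = no λ ()

  isEvo? : Decidable (IsEvo {nO} {nH})
  isEvo? (evo _ _ _) = yes tt
  isEvo? (into _ _ _) = no λ ()
  isEvo? (out _ _ _) = no λ ()
  isEvo? (div _ _ _ _) = no λ ()

  isDiv? : Decidable (IsDiv {nO} {nH})
  isDiv? (div _ _ _ _) = yes tt
  isDiv? (evo _ _ _) = no λ ()
  isDiv? (into _ _ _) = no λ ()
  isDiv? (out _ _ _) = no λ ()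

  subjectCond? : ∀ b (rs : List (Rule nO nH)) → Dec (SubjectCond b rs)
  subjectCond? true rs = All.all? isEvo? rs
  subjectCond? false rs = _ ℕₚ.≤? 1

  _⊆ₘ?_ : ∀ (u v : Multiset nO) → Dec (u ⊆ₘ v)
  u ⊆ₘ? v = Finₚ.all? (λ j → lookup u j ℕₚ.≤? lookup v j)

  []? : ∀ {A : Set} (xs : List A) → Dec (xs ≡ [])
  []? [] = yes refl
  []? (_ ∷ _) = no λ ()

  open Data.List.Membership.DecPropositional _≟ʳ_ using (_∈?_)

  mutual
    valid? : ∀ R b (T : ATree nO nH) → Dec (Valid R b T)
    valid? R b (anode h m rs cs) =
      All.all? (λ r → r ∈? R) rs ×-dec
      All.all? (λ r → ruleLabel r ≟ h) rs ×-dec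
      subjectCond? b rs ×-dec
      All.all? (λ r → isDiv? r →-dec []? cs) rs ×-dec
      consumed rs cs ⊆ₘ? m ×-dec
      validL? R cs

    validL? : ∀ R (cs : List (ATree nO nH)) → Dec (ValidL R cs)
    validL? R [] = yes tt
    validL? R (c ∷ cs) = valid? R false c ×-dec validL? R cs

-- Every valid annotation extends to a maximal one; hence computations can always
-- be continued, and under AllHalt continued until they halt.

module _ {nO nH : ℕ} (R : List (Rule nO nH)) where

  mutual
    extensions : ATree nO nH → List (ATree nO nH)
    extensions (anode h m rs cs) =
      map (λ r → anode h m (r ∷ rs) cs) R ++ map (anode h m rs) (extensionsL cs)

    extensionsL : List (ATree nO nH) → List (List (ATree nO nH))
    extensionsL [] = []
    extensionsL (c ∷ cs) = map (_∷ cs) (extensions c) ++ map (c ∷_) (extensionsL cs)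

  mutual
    extensions-sound : ∀ T {T'} → T' ∈ extensions T → T ⊏ T'
    extensions-sound (anode h m rs cs) T'∈ with ∈-++⁻ (map (λ r → anode h m (r ∷ rs) cs) R) T'∈
    ... | inj₁ here-new with ∈-map⁻ (λ r → anode h m (r ∷ rs) cs) here-new
    ...   | r , _ , refl = here r
    extensions-sound (anode h m rs cs) T'∈ | inj₂ below with ∈-map⁻ (anode h m rs) below
    ...   | cs' , cs'∈ , refl = there (extensionsL-sound cs cs'∈)

    extensionsL-sound : ∀ cs {cs'} → cs' ∈ extensionsL cs → cs ⊏ₗ cs'
    extensionsL-sound (c ∷ cs) cs'∈ with ∈-++⁻ (map (_∷ cs) (extensions c)) cs'∈
    ... | inj₁ at-head with ∈-map⁻ (_∷ cs) at-head
    ...   | c' , c'∈ , refl = hd (extensions-sound c c'∈)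
    extensionsL-sound (c ∷ cs) cs'∈ | inj₂ in-tail with ∈-map⁻ (c ∷_) in-tail
    ...   | cs' , cs'∈ , refl = tl (extensionsL-sound cs cs'∈)

  mutual
    extensions-complete : ∀ {b T T'} → T ⊏ T' → Valid R b T' → T' ∈ extensions T
    extensions-complete (here {h} {m} {rs} {cs} r) ((r∈R ∷ _) , _) =
      ∈-++⁺ˡ (∈-map⁺ (λ r → anode h m (r ∷ rs) cs) r∈R)
    extensions-complete (there {h} {m} {rs} {cs} p) (_ , _ , _ , _ , _ , vcs) =
      ∈-++⁺ʳ (map (λ r → anode h m (r ∷ rs) cs) R) (∈-map⁺ (anode h m rs) (extensionsL-complete p vcs))

    extensionsL-complete : ∀ {cs cs'} → cs ⊏ₗ cs' → ValidL R cs' → cs' ∈ extensionsL cs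
    extensionsL-complete (hd {cs = cs} p) (v , _) = ∈-++⁺ˡ (∈-map⁺ (_∷ cs) (extensions-complete p v))
    extensionsL-complete (tl {c} p) (_ , vs) =
      ∈-++⁺ʳ (map (_∷ _) (extensions c)) (∈-map⁺ (c ∷_) (extensionsL-complete p vs))

  extend-or-maximal : ∀ T → (Σ (ATree nO nH) λ T' → T ⊏ T' × Valid R true T') ⊎ Maximal R T
  extend-or-maximal T with any? (valid? R true) (extensions T)
  ... | yes some = let (T' , T'∈ , v) = find some in inj₁ (T' , extensions-sound T T'∈ , v)
  ... | no none = inj₂ λ T' T⊏T' v → none (lose (extensions-complete T⊏T' v) v)

module _ {nO nH : ℕ} where

  mutual
    ⊏-erase : ∀ {T T' : ATree nO nH} → T ⊏ T' → erase T' ≡ erase T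
    ⊏-erase (here r) = refl
    ⊏-erase (there {h} {m} p) = cong (mem h m) (⊏ₗ-erase p)

    ⊏ₗ-erase : ∀ {cs cs' : List (ATree nO nH)} → cs ⊏ₗ cs' → eraseL cs' ≡ eraseL cs
    ⊏ₗ-erase (hd {cs = cs} p) = cong (_∷ eraseL cs) (⊏-erase p)
    ⊏ₗ-erase (tl {c} p) = cong (erase c ∷_) (⊏ₗ-erase p)

  mutual
    ⊏-ruleCount : ∀ {T T' : ATree nO nH} → T ⊏ T' → ruleCount T' ≡ suc (ruleCount T)
    ⊏-ruleCount (here r) = refl
    ⊏-ruleCount (there {rs = rs} p) = trans (cong (length rs +_) (⊏ₗ-ruleCount p)) (ℕₚ.+-suc (length rs) _)

    ⊏ₗ-ruleCount : ∀ {cs cs' : List (ATree nO nH)} → cs ⊏ₗ cs' → ruleCountL cs' ≡ suc (ruleCountL cs)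
    ⊏ₗ-ruleCount (hd {cs = cs} p) = cong (_+ ruleCountL cs) (⊏-ruleCount p)
    ⊏ₗ-ruleCount (tl {c} p) = trans (cong (ruleCount c +_) (⊏ₗ-ruleCount p)) (ℕₚ.+-suc (ruleCount c) _)

  mutual
    ⊏-objects : ∀ {T T' : ATree nO nH} → T ⊏ T' → objects T' ≡ objects T
    ⊏-objects (here r) = refl
    ⊏-objects (there {m = m} p) = cong (size m +_) (⊏ₗ-objects p)

    ⊏ₗ-objects : ∀ {cs cs' : List (ATree nO nH)} → cs ⊏ₗ cs' → objectsL cs' ≡ objectsL cs
    ⊏ₗ-objects (hd {cs = cs} p) = cong (_+ objectsL cs) (⊏-objects p)
    ⊏ₗ-objects (tl {c} p) = cong (objects c +_) (⊏ₗ-objects p)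

  _⊏*_ : ATree nO nH → ATree nO nH → Set
  _⊏*_ = Star _⊏_

  ⊏*-erase : ∀ {T T'} → T ⊏* T' → erase T' ≡ erase T
  ⊏*-erase ε = refl
  ⊏*-erase (p ◅ ps) = trans (⊏*-erase ps) (⊏-erase p)

  ⊏*-ruleCount : ∀ {T T'} → T ⊏* T' → ruleCount T ≤ ruleCount T'
  ⊏*-ruleCount ε = ≤-refl
  ⊏*-ruleCount (p ◅ ps) = ≤-trans (ℕₚ.n≤1+n _) (≤-trans (≤-reflexive (sym (⊏-ruleCount p))) (⊏*-ruleCount ps))

  mutual
    erase-bare : ∀ (C : Mem nO nH) → erase (bare C) ≡ C
    erase-bare (mem h m cs) = cong (mem h m) (eraseL-bareL cs)

    eraseL-bareL : ∀ (cs : List (Mem nO nH)) → eraseL (bareL cs) ≡ cs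
    eraseL-bareL [] = refl
    eraseL-bareL (c ∷ cs) = cong₂ _∷_ (erase-bare c) (eraseL-bareL cs)

  mutual
    ruleCount-bare : ∀ (C : Mem nO nH) → ruleCount (bare C) ≡ 0
    ruleCount-bare (mem h m cs) = ruleCountL-bareL cs

    ruleCountL-bareL : ∀ (cs : List (Mem nO nH)) → ruleCountL (bareL cs) ≡ 0
    ruleCountL-bareL [] = refl
    ruleCountL-bareL (c ∷ cs) = cong₂ _+_ (ruleCount-bare c) (ruleCountL-bareL cs)

  divOf-evo : ∀ (rs : List (Rule nO nH)) → All IsEvo rs → divOf rs ≡ nothing
  divOf-evo [] _ = refl
  divOf-evo (evo _ _ _ ∷ rs) (_ ∷ evos) = divOf-evo rs evos

  -- the environment does not divide, so a step yields a single configuration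
  root-result : ∀ {R} (T : ATree nO nH) → Valid R true T → Σ (Mem nO nH) λ C' → result T ≡ C' ∷ []
  root-result (anode h m rs cs) (_ , _ , evos , _) rewrite divOf-evo rs evos = _ , refl

module _ {nO nH : ℕ} (R : List (Rule nO nH)) where

  -- Adding valid rule applications one at a time terminates: at the root
  -- the number of rules is bounded by the (unchanging) number of objects.
  saturate : ∀ k (T : ATree nO nH) → Valid R true T → objects T ≤ ruleCount T + k →
             Σ (ATree nO nH) λ T' → T ⊏* T' × Valid R true T' × Maximal R T'
  saturate k T v bound with extend-or-maximal R T
  ... | inj₂ maximal = T , ε , v , maximal
  ... | inj₁ (T₁ , T⊏T₁ , v₁) with k
  ...   | zero = ⊥-elim (ℕₚ.1+n≰n (begin
          suc (ruleCount T)               ≡⟨ sym (⊏-ruleCount T⊏T₁) ⟩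
          ruleCount T₁                    ≤⟨ ruleCount-bound T₁ v₁ ⟩
          objects T₁ + demand T₁          ≡⟨ cong₂ _+_ (⊏-objects T⊏T₁) (demand-root T₁ v₁) ⟩
          objects T + 0                   ≤⟨ ≤-trans (≤-reflexive (ℕₚ.+-identityʳ _)) bound ⟩
          ruleCount T + 0                 ≡⟨ ℕₚ.+-identityʳ _ ⟩
          ruleCount T                     ∎))
          where open ≤-Reasoning
  ...   | suc k' with saturate k' T₁ v₁ (begin
          objects T₁                      ≡⟨ ⊏-objects T⊏T₁ ⟩
          objects T                       ≤⟨ bound ⟩
          ruleCount T + suc k'            ≡⟨ ℕₚ.+-suc _ _ ⟩
          suc (ruleCount T) + k'          ≡⟨ cong (_+ k') (sym (⊏-ruleCount T⊏T₁)) ⟩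
          ruleCount T₁ + k'               ∎)
          where open ≤-Reasoning
  ...     | T' , T₁⊏*T' , v' , maximal = T' , T⊏T₁ ◅ T₁⊏*T' , v' , maximal

  record StepAbove (C : Mem nO nH) (T : ATree nO nH) : Set where
    field
      {next}   : Mem nO nH
      tree     : ATree nO nH
      extends  : T ⊏* tree
      valid    : Valid R true tree
      result≡  : result tree ≡ next ∷ []
      stepped : Step R C next

  step-above : ∀ C (T : ATree nO nH) → erase T ≡ C → 1 ≤ ruleCount T → Valid R true T → StepAbove C T
  step-above C T erase≡ nonEmpty v with saturate (objects T) T v (m≤n+m _ _)
  ... | T' , T⊏*T' , v' , maximal with root-result T' v'
  ...   | C' , result≡ = record
    { tree = T' ; extends = T⊏*T' ; valid = v' ; result≡ = result≡
    ; stepped = T' , trans (⊏*-erase T⊏*T') erase≡ , v' , maximal , ≤-trans nonEmpty (⊏*-ruleCount T⊏*T') , result≡ }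

  halting-run : ∀ (P : Mem nO nH → Set) → (∀ {C C'} → Step R C C' → P C → P C') →
    ∀ C → AllHalt R C → P C → Σ ℕ λ s → Σ (Mem nO nH) λ E → Reach R C s E × Halted R E × P E
  halting-run P preserved C (acc rest) pC with extend-or-maximal R (bare C)
  ... | inj₂ halted = 0 , C , done , halted , pC
  ... | inj₁ (T , bare⊏T , v) with step-above C T (trans (⊏-erase bare⊏T) (erase-bare C))
         (subst (1 ≤_) (sym (trans (⊏-ruleCount bare⊏T) (cong suc (ruleCount-bare C)))) ≤-refl) v
  ...   | record { stepped = st } with halting-run P preserved _ (rest st) (preserved st pC)
  ...     | s , E , run , halted , pE = suc s , E , step st run , halted , pE

module _ {A : Set} where

  unique-head : ∀ {x : A} {xs} → Unique (x ∷ xs) → x ∉ xs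
  unique-head (x∉xs ∷ _) x∈xs = All.lookup x∉xs x∈xs refl

  unique-tail : ∀ {x : A} {xs} → Unique (x ∷ xs) → Unique xs
  unique-tail (_ ∷ u) = u

  unique-++ˡ : ∀ (xs : List A) {ys} → Unique (xs ++ ys) → Unique xs
  unique-++ˡ [] _ = []
  unique-++ˡ (x ∷ xs) (x∉ ∷ u) = All.tabulate (λ x'∈xs → All.lookup x∉ (∈-++⁺ˡ x'∈xs)) ∷ unique-++ˡ xs u

  unique-++ʳ : ∀ (xs : List A) {ys} → Unique (xs ++ ys) → Unique ys
  unique-++ʳ [] u = u
  unique-++ʳ (x ∷ xs) (_ ∷ u) = unique-++ʳ xs u

  unique-++-disjoint : ∀ (xs : List A) {ys a} → Unique (xs ++ ys) → a ∈ xs → a ∉ ys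
  unique-++-disjoint (x ∷ xs) u (here refl) a∈ys = unique-head u (∈-++⁺ʳ xs a∈ys)
  unique-++-disjoint (x ∷ xs) (_ ∷ u) (there a∈xs) a∈ys = unique-++-disjoint xs u a∈xs a∈ys

module _ {nO nH : ℕ} where

  children : Mem nO nH → List (Mem nO nH)
  children (mem _ _ cs) = cs

  content : Mem nO nH → Multiset nO
  content (mem _ m _) = m

  childLabels : Mem nO nH → List (Fin nH)
  childLabels C = map labelOf (children C)

  data Position : Mem nO nH → Set where
    top   : ∀ {C} → Position C
    below : ∀ {h m cs c} → c ∈ cs → Position c → Position (mem h m cs)

  at : ∀ {C} → Position C → Mem nO nH
  at {C} top = C
  at (below _ p) = at p

  data Edge : Mem nO nH → Fin nH → Fin nH → Set where
    edge-top   : ∀ {b m cs a} → a ∈ map labelOf cs → Edge (mem b m cs) a b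
    edge-below : ∀ {h m cs c a b} → c ∈ cs → Edge c a b → Edge (mem h m cs) a b

  edge-at : ∀ {C a} (p : Position C) → a ∈ childLabels (at p) → Edge C a (labelOf (at p))
  edge-at {mem _ _ _} top a∈ = edge-top a∈
  edge-at (below c∈ p) a∈ = edge-below c∈ (edge-at p a∈)

  edge-position : ∀ {C a b} → Edge C a b → Σ (Position C) λ p → labelOf (at p) ≡ b × a ∈ childLabels (at p)
  edge-position (edge-top a∈) = top , refl , a∈
  edge-position (edge-below c∈ e) with edge-position e
  ... | p , label≡ , a∈ = below c∈ p , label≡ , a∈

  labelOf∈labels : ∀ (C : Mem nO nH) → labelOf C ∈ labels C
  labelOf∈labels (mem _ _ _) = here refl

  labels-child : ∀ {c : Mem nO nH} {cs a} → c ∈ cs → a ∈ labels c → a ∈ labelsL cs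
  labels-child {cs = c ∷ cs} (here refl) a∈ = ∈-++⁺ˡ a∈
  labels-child {cs = c' ∷ cs} (there c∈) a∈ = ∈-++⁺ʳ (labels c') (labels-child c∈ a∈)

  labels-at : ∀ {C} (p : Position C) → labelOf (at p) ∈ labels C
  labels-at {C} top = labelOf∈labels C
  labels-at (below c∈ p) = there (labels-child c∈ (labels-at p))

  edge-labels : ∀ {C a b} → Edge C a b → a ∈ labelsL (children C)
  edge-labels (edge-top {cs = cs} a∈) with ∈-map⁻ labelOf a∈
  ... | mem _ _ _ , c∈ , refl = labels-child c∈ (here refl)
  edge-labels (edge-below {c = mem _ _ _} c∈ e) = labels-child c∈ (there (edge-labels e))

  edge-labels′ : ∀ {C a b} → Edge C a b → a ∈ labels C
  edge-labels′ {mem _ _ _} e = there (edge-labels e)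

  same-child : ∀ {cs : List (Mem nO nH)} {c c' a} → Unique (labelsL cs) → c ∈ cs → c' ∈ cs →
               a ∈ labels c → a ∈ labels c' → c ≡ c' × Unique (labels c)
  same-child {c ∷ cs} u (here refl) (here refl) _ _ = refl , unique-++ˡ (labels c) u
  same-child {c ∷ cs} u (here refl) (there c'∈) a∈ a∈' = ⊥-elim (unique-++-disjoint (labels c) u a∈ (labels-child c'∈ a∈'))
  same-child {c ∷ cs} u (there c∈) (here refl) a∈ a∈' = ⊥-elim (unique-++-disjoint (labels c) u a∈' (labels-child c∈ a∈))
  same-child {c ∷ cs} u (there c∈) (there c'∈) a∈ a∈' = same-child (unique-++ʳ (labels c) u) c∈ c'∈ a∈ a∈'

  edge-not-root : ∀ {C : Mem nO nH} {a b} → Unique (labels C) → Edge C a b → a ≢ labelOf C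
  edge-not-root {C = mem _ _ _} u e refl = unique-head u (edge-labels e)

  child-not-below : ∀ {h cs c a b} → Unique (h ∷ labelsL cs) → a ∈ map labelOf cs → c ∈ cs → Edge c a b → ⊥
  child-not-below u a∈ c∈ e with ∈-map⁻ labelOf a∈
  ... | c₁ , c₁∈ , refl with same-child (unique-tail u) c₁∈ c∈ (labelOf∈labels c₁) (edge-labels′ e)
  ...   | refl , u' = edge-not-root u' e refl

  edge-functional : ∀ {C : Mem nO nH} {a b b'} → Unique (labels C) → Edge C a b → Edge C a b' → b ≡ b'
  edge-functional {C = mem _ _ _} u (edge-top _) (edge-top _) = refl
  edge-functional {C = mem h m cs} u (edge-top a∈) (edge-below c'∈ e) = ⊥-elim (child-not-below u a∈ c'∈ e)
  edge-functional {C = mem h m cs} u (edge-below c∈ e) (edge-top a∈) = ⊥-elim (child-not-below u a∈ c∈ e)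
  edge-functional {C = mem h m cs} u (edge-below c∈ e) (edge-below c'∈ e')
    with same-child (unique-tail u) c∈ c'∈ (edge-labels′ e) (edge-labels′ e')
  ... | refl , u' = edge-functional u' e e'

  same-label : ∀ {C : Mem nO nH} → Unique (labels C) → (p q : Position C) → labelOf (at p) ≡ labelOf (at q) → at p ≡ at q
  same-label u top top _ = refl
  same-label {C = mem h m cs} u top (below c∈ q) e =
    ⊥-elim (unique-head u (subst (_∈ labelsL cs) (sym e) (labels-child c∈ (labels-at q))))
  same-label {C = mem h m cs} u (below c∈ p) top e =
    ⊥-elim (unique-head u (subst (_∈ labelsL cs) e (labels-child c∈ (labels-at p))))
  same-label {C = mem h m cs} u (below c∈ p) (below c'∈ q) e
    with same-child (unique-tail u) c∈ c'∈ (labels-at p) (subst (_∈ labels _) (sym e) (labels-at q))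
  ... | refl , u' = same-label u' p q e

  edge-children : ∀ {C : Mem nO nH} → Unique (labels C) → (p : Position C) → ∀ {a} → Edge C a (labelOf (at p)) → a ∈ childLabels (at p)
  edge-children u p e with edge-position e
  ... | q , label≡ , a∈ rewrite same-label u p q (sym label≡) = a∈

module _ {nO nH : ℕ} where

  result-labels : ∀ (T : ATree nO nH) → All (λ d → labelOf d ≡ labelOf (erase T)) (result T)
  result-labels (anode h m rs cs) with divOf rs
  ... | nothing = refl ∷ []
  ... | just _ = refl ∷ refl ∷ []

  result-nonempty : ∀ (T : ATree nO nH) → labelOf (erase T) ∈ map labelOf (result T)
  result-nonempty (anode h m rs cs) with divOf rs
  ... | nothing = here refl
  ... | just _ = here refl

  ∈-resultL⁻ : ∀ {d} (cs : List (ATree nO nH)) → d ∈ resultL cs → Σ (ATree nO nH) λ c → c ∈ cs × d ∈ result c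
  ∈-resultL⁻ (c ∷ cs) d∈ with ∈-++⁻ (result c) d∈
  ... | inj₁ d∈c = c , here refl , d∈c
  ... | inj₂ d∈cs with ∈-resultL⁻ cs d∈cs
  ...   | c' , c'∈ , d∈c' = c' , there c'∈ , d∈c'

  ∈-resultL⁺ : ∀ {d c} (cs : List (ATree nO nH)) → c ∈ cs → d ∈ result c → d ∈ resultL cs
  ∈-resultL⁺ (c ∷ cs) (here refl) d∈ = ∈-++⁺ˡ d∈
  ∈-resultL⁺ (c ∷ cs) (there c∈) d∈ = ∈-++⁺ʳ (result c) (∈-resultL⁺ cs c∈ d∈)

  ∈-eraseL⁻ : ∀ {d} (cs : List (ATree nO nH)) → d ∈ eraseL cs → Σ (ATree nO nH) λ c → c ∈ cs × d ≡ erase c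
  ∈-eraseL⁻ (c ∷ cs) (here d≡) = c , here refl , d≡
  ∈-eraseL⁻ (c ∷ cs) (there d∈) with ∈-eraseL⁻ cs d∈
  ... | c' , c'∈ , d≡ = c' , there c'∈ , d≡

  ∈-eraseL⁺ : ∀ {c} (cs : List (ATree nO nH)) → c ∈ cs → erase c ∈ eraseL cs
  ∈-eraseL⁺ (c ∷ cs) (here refl) = here refl
  ∈-eraseL⁺ (c ∷ cs) (there c∈) = there (∈-eraseL⁺ cs c∈)

  resultL-labels⁻ : ∀ {a} (cs : List (ATree nO nH)) → a ∈ map labelOf (resultL cs) → a ∈ map labelOf (eraseL cs)
  resultL-labels⁻ cs a∈ with ∈-map⁻ labelOf a∈
  ... | d , d∈ , refl with ∈-resultL⁻ cs d∈
  ...   | c , c∈ , d∈c = subst (_∈ map labelOf (eraseL cs)) (sym (All.lookup (result-labels c) d∈c))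
                                (∈-map⁺ labelOf (∈-eraseL⁺ cs c∈))

  resultL-labels⁺ : ∀ {a} (cs : List (ATree nO nH)) → a ∈ map labelOf (eraseL cs) → a ∈ map labelOf (resultL cs)
  resultL-labels⁺ cs a∈ with ∈-map⁻ labelOf a∈
  ... | d , d∈ , refl with ∈-eraseL⁻ cs d∈
  ...   | c , c∈ , refl with ∈-map⁻ labelOf (result-nonempty c)
  ...     | d' , d'∈ , label≡ = subst (_∈ map labelOf (resultL cs)) (sym label≡) (∈-map⁺ labelOf (∈-resultL⁺ cs c∈ d'∈))

module Shape {nO nH : ℕ} (Π : System nO nH) where
  open System Π using (env; rules; initial; initialEnv; initialInj)

  -- ls are the labels of the children of the membrane labelled b in the
  -- initial configuration (ignoring multiplicities)
  ChildLabelsOK : Fin nH → List (Fin nH) → Set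
  ChildLabelsOK b ls = (∀ {a} → a ∈ ls → Edge initial a b) × (∀ {a} → Edge initial a b → a ∈ ls)

  mutual
    WellShaped : Mem nO nH → Set
    WellShaped (mem b _ cs) = ChildLabelsOK b (map labelOf cs) × WellShapedL cs

    WellShapedL : List (Mem nO nH) → Set
    WellShapedL [] = ⊤
    WellShapedL (c ∷ cs) = WellShaped c × WellShapedL cs

  Invariant : Mem nO nH → Set
  Invariant C = labelOf C ≡ env × WellShaped C

  wellShapedL-∈ : ∀ {c} (cs : List (Mem nO nH)) → WellShapedL cs → c ∈ cs → WellShaped c
  wellShapedL-∈ (c ∷ cs) (w , _) (here refl) = w
  wellShapedL-∈ (c ∷ cs) (_ , ws) (there c∈) = wellShapedL-∈ cs ws c∈

  wellShapedL-++ : ∀ (xs ys : List (Mem nO nH)) → WellShapedL xs → WellShapedL ys → WellShapedL (xs ++ ys)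
  wellShapedL-++ [] ys _ wys = wys
  wellShapedL-++ (x ∷ xs) ys (wx , wxs) wys = wx , wellShapedL-++ xs ys wxs wys

  wellShaped-at : ∀ {C} (p : Position C) → WellShaped C → WellShaped (at p)
  wellShaped-at top w = w
  wellShaped-at (below {cs = cs} c∈ p) (_ , ws) = wellShaped-at p (wellShapedL-∈ cs ws c∈)

  childLabels-at : ∀ {C} (p : Position C) → WellShaped C → ChildLabelsOK (labelOf (at p)) (childLabels (at p))
  childLabels-at p w with at p | wellShaped-at p w
  ... | mem _ _ _ | (ok , _) = ok

  mutual
    wellShaped-from-positions : ∀ (C : Mem nO nH) → (∀ (p : Position C) → ChildLabelsOK (labelOf (at p)) (childLabels (at p))) →
                     WellShaped C
    wellShaped-from-positions (mem b m cs) ok = ok top , wellShapedL-from-positions cs (λ c∈ p → ok (below c∈ p))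

    wellShapedL-from-positions : ∀ (cs : List (Mem nO nH)) →
                      (∀ {c} → c ∈ cs → (p : Position c) → ChildLabelsOK (labelOf (at p)) (childLabels (at p))) →
                      WellShapedL cs
    wellShapedL-from-positions [] _ = tt
    wellShapedL-from-positions (c ∷ cs) ok =
      wellShaped-from-positions c (ok (here refl)) , wellShapedL-from-positions cs (λ c∈ → ok (there c∈))

  invariant-initial : Invariant initial
  invariant-initial = initialEnv , wellShaped-from-positions initial (λ p → edge-at p , edge-children initialInj p)

  edge-initial : ∀ {C a b} → WellShaped C → Edge C a b → Edge initial a b
  edge-initial w e with edge-position e
  ... | p , refl , a∈ = proj₁ (childLabels-at p w) a∈

  -- Steps preserve the invariant: divided copies keep their children's labels,
  -- and the labels below a membrane are those of the membranes they come from.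
  transport : ∀ {b ls ls'} → ChildLabelsOK b ls → (∀ {a} → a ∈ ls' → a ∈ ls) → (∀ {a} → a ∈ ls → a ∈ ls') →
              ChildLabelsOK b ls'
  transport (sound , complete) ls'⊆ls ls⊆ls' = (λ a∈ → sound (ls'⊆ls a∈)) , (λ e → ls⊆ls' (complete e))

  mkNodes-wellShaped : ∀ h base (cs' : List (Mem nO nH)) dv → ChildLabelsOK h (map labelOf cs') → WellShapedL cs' →
                       WellShapedL (mkNodes h base cs' dv)
  mkNodes-wellShaped h base cs' nothing ok ws = (ok , ws) , tt
  mkNodes-wellShaped h base cs' (just _) ok ws = (ok , ws) , (ok , ws) , tt

  mutual
    result-wellShaped : ∀ (T : ATree nO nH) → WellShaped (erase T) → WellShapedL (result T)
    result-wellShaped (anode h m rs cs) (ok , ws) =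
      mkNodes-wellShaped h _ (resultL cs) (divOf rs)
        (transport ok (resultL-labels⁻ cs) (resultL-labels⁺ cs)) (resultL-wellShaped cs ws)

    resultL-wellShaped : ∀ (cs : List (ATree nO nH)) → WellShapedL (eraseL cs) → WellShapedL (resultL cs)
    resultL-wellShaped [] _ = tt
    resultL-wellShaped (c ∷ cs) (w , ws) =
      wellShapedL-++ (result c) (resultL cs) (result-wellShaped c w) (resultL-wellShaped cs ws)

  invariant-step : ∀ {C C'} → Step rules C C' → Invariant C → Invariant C'
  invariant-step {C' = C'} (T , refl , _ , _ , _ , result≡) (root≡ , w) =
    trans (All.lookup (result-labels T) C'∈) root≡ , wellShapedL-∈ (result T) (result-wellShaped T w) C'∈
    where
    C'∈ : C' ∈ result T
    C'∈ = subst (C' ∈_) (sym result≡) (here refl)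

  invariant-reach : ∀ {C t C'} → Reach rules C t C' → Invariant C → Invariant C'
  invariant-reach done inv = inv
  invariant-reach (step st run) inv = invariant-reach run (invariant-step st inv)

  childLabels-clearL : ∀ (cs : List (Mem nO nH)) → map labelOf (clearL cs) ≡ map labelOf cs
  childLabels-clearL [] = refl
  childLabels-clearL (mem h _ _ ∷ cs) = cong (h ∷_) (childLabels-clearL cs)

  childLabels-isolateL : ∀ (cs : List (Mem nO nH)) k p o → map labelOf (isolateL cs k p o) ≡ map labelOf cs
  childLabels-isolateL [] k p o = refl
  childLabels-isolateL (mem h _ _ ∷ cs) zero [] o = cong (h ∷_) (childLabels-clearL cs)
  childLabels-isolateL (mem h _ _ ∷ cs) zero (_ ∷ _) o = cong (h ∷_) (childLabels-clearL cs)
  childLabels-isolateL (mem h _ _ ∷ cs) (suc k) p o = cong (h ∷_) (childLabels-isolateL cs k p o)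

  mutual
    clear-wellShaped : ∀ (C : Mem nO nH) → WellShaped C → WellShaped (clear C)
    clear-wellShaped (mem b m cs) (ok , ws) = subst (ChildLabelsOK b) (sym (childLabels-clearL cs)) ok , clearL-wellShaped cs ws

    clearL-wellShaped : ∀ (cs : List (Mem nO nH)) → WellShapedL cs → WellShapedL (clearL cs)
    clearL-wellShaped [] _ = tt
    clearL-wellShaped (c ∷ cs) (w , ws) = clear-wellShaped c w , clearL-wellShaped cs ws

  mutual
    isolate-wellShaped : ∀ (C : Mem nO nH) p o → WellShaped C → WellShaped (isolate C p o)
    isolate-wellShaped (mem b m cs) [] o (ok , ws) =
      subst (ChildLabelsOK b) (sym (childLabels-clearL cs)) ok , clearL-wellShaped cs ws
    isolate-wellShaped (mem b m cs) (k ∷ p) o (ok , ws) =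
      subst (ChildLabelsOK b) (sym (childLabels-isolateL cs k p o)) ok , isolateL-wellShaped cs k p o ws

    isolateL-wellShaped : ∀ (cs : List (Mem nO nH)) k p o → WellShapedL cs → WellShapedL (isolateL cs k p o)
    isolateL-wellShaped [] k p o _ = tt
    isolateL-wellShaped (c ∷ cs) zero p o (w , ws) = isolate-wellShaped c p o w , clearL-wellShaped cs ws
    isolateL-wellShaped (c ∷ cs) (suc k) p o (w , ws) = clear-wellShaped c w , isolateL-wellShaped cs k p o ws

  invariant-isolate : ∀ (C : Mem nO nH) p o → Invariant C → Invariant (isolate C p o)
  invariant-isolate (mem h m cs) [] o (root≡ , w) = root≡ , isolate-wellShaped (mem h m cs) [] o w
  invariant-isolate (mem h m cs) (k ∷ p) o (root≡ , w) = root≡ , isolate-wellShaped (mem h m cs) (k ∷ p) o w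

  below-not-env : ∀ {h m cs c} → WellShaped (mem h m cs) → c ∈ cs → (p : Position c) → labelOf (at p) ≢ env
  below-not-env {cs = cs} (ok , _) c∈ top label≡env =
    edge-not-root initialInj (proj₁ ok (∈-map⁺ labelOf c∈)) (trans label≡env (sym initialEnv))
  below-not-env {cs = cs} {c = mem hc mc csc} (_ , ws) c∈ (below c'∈ p) =
    below-not-env {hc} {mc} {csc} (wellShapedL-∈ cs ws c∈) c'∈ p

  elementary : ∀ (N : Mem nO nH) → WellShaped N → (∀ a → ¬ Edge initial a (labelOf N)) → children N ≡ []
  elementary (mem b m []) _ _ = refl
  elementary (mem b m (c ∷ cs)) (ok , _) no-child = ⊥-elim (no-child _ (proj₁ ok (here refl)))

  child-labelled : ∀ (N : Mem nO nH) {a} → WellShaped N → Edge initial a (labelOf N) →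
                   Σ (Mem nO nH) λ d → d ∈ children N × labelOf d ≡ a
  child-labelled (mem b m ds) (ok , _) e with ∈-map⁻ labelOf (proj₂ ok e)
  ... | d , d∈ , label≡ = d , d∈ , sym label≡

module _ {nO nH : ℕ} where

  Occurs : Mem nO nH → Fin nH → Fin nO → Set
  Occurs C h x = Σ (Position C) λ p → labelOf (at p) ≡ h × x ∈ₘ content (at p)

  occurs-below : ∀ {h m cs c h₁ x} → c ∈ cs → Occurs c h₁ x → Occurs (mem h m cs) h₁ x
  occurs-below c∈ (p , label≡ , x∈) = below c∈ p , label≡ , x∈

  module _ (m : Multiset nO) (rs : List (Rule nO nH)) (cs : List (ATree nO nH)) where

    leftover fromEvo fromChildren fromParent : Multiset nO
    leftover = m ⊖ consumed rs cs
    fromEvo = Σₘ (map rhsA rs)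
    fromChildren = childProduction cs
    fromParent = Σₘ (map rhsIn rs)

    -- the whole contents (before adding the objects distinguishing the copies of a division)
    afterEvo afterChildren afterStep : Multiset nO
    afterEvo = leftover ⊕ fromEvo
    afterChildren = afterEvo ⊕ fromChildren
    afterStep = afterChildren ⊕ fromParent

    afterChildren-⊆ₘ : afterChildren ⊆ₘ afterStep
    afterChildren-⊆ₘ = ⊆ₘ-⊕ˡ afterChildren fromParent

    afterEvo-⊆ₘ : afterEvo ⊆ₘ afterStep
    afterEvo-⊆ₘ j = ≤-trans (⊆ₘ-⊕ˡ afterEvo fromChildren j) (afterChildren-⊆ₘ j)

    leftover-⊆ₘ : leftover ⊆ₘ afterStep
    leftover-⊆ₘ j = ≤-trans (⊆ₘ-⊕ˡ leftover fromEvo j) (afterEvo-⊆ₘ j)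

    fromEvo-⊆ₘ : fromEvo ⊆ₘ afterStep
    fromEvo-⊆ₘ j = ≤-trans (⊆ₘ-⊕ʳ leftover fromEvo j) (afterEvo-⊆ₘ j)

    fromChildren-⊆ₘ : fromChildren ⊆ₘ afterStep
    fromChildren-⊆ₘ j = ≤-trans (⊆ₘ-⊕ʳ afterEvo fromChildren j) (afterChildren-⊆ₘ j)

    fromParent-⊆ₘ : fromParent ⊆ₘ afterStep
    fromParent-⊆ₘ = ⊆ₘ-⊕ʳ afterChildren fromParent

    data Provenance (x : Fin nO) : Set where
      untouched : x ∈ₘ m → Provenance x
      evolved   : ∀ {h o w} → evo h o w ∈ rs → x ∈ₘ w → Provenance x
      sent-out  : ∀ {c h o} → c ∈ cs → out h o x ∈ rulesOf c → Provenance x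
      sent-in   : ∀ {h o} → into h o x ∈ rs → Provenance x

    provenance : ∀ {x} → x ∈ₘ afterStep → Provenance x
    provenance {x} x∈ with ∈ₘ-⊕⁻ afterChildren fromParent x∈
    ... | inj₂ x∈in with ∈ₘ-Σₘ⁻ rhsIn rs x∈in
    ...   | into _ _ u , r∈ , x∈u rewrite ∈ₘ-single⁻ u x x∈u = sent-in r∈
    ...   | evo _ _ _ , _ , x∈∅ = ⊥-elim (∉ₘ-∅ x x∈∅)
    ...   | out _ _ _ , _ , x∈∅ = ⊥-elim (∉ₘ-∅ x x∈∅)
    ...   | div _ _ _ _ , _ , x∈∅ = ⊥-elim (∉ₘ-∅ x x∈∅)
    provenance {x} x∈ | inj₁ x∈′ with ∈ₘ-⊕⁻ afterEvo fromChildren x∈′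
    ... | inj₂ x∈out with ∈ₘ-Σₘ⁻ (λ c → Σₘ (map rhsOut (rulesOf c))) cs x∈out
    ...   | c , c∈ , x∈c with ∈ₘ-Σₘ⁻ rhsOut (rulesOf c) x∈c
    ...     | out _ _ u , r∈ , x∈u rewrite ∈ₘ-single⁻ u x x∈u = sent-out c∈ r∈
    ...     | evo _ _ _ , _ , x∈∅ = ⊥-elim (∉ₘ-∅ x x∈∅)
    ...     | into _ _ _ , _ , x∈∅ = ⊥-elim (∉ₘ-∅ x x∈∅)
    ...     | div _ _ _ _ , _ , x∈∅ = ⊥-elim (∉ₘ-∅ x x∈∅)
    provenance {x} x∈ | inj₁ x∈′ | inj₁ x∈″ with ∈ₘ-⊕⁻ leftover fromEvo x∈″
    ... | inj₁ x∈m = untouched (∈ₘ-⊖⁻ m (consumed rs cs) x∈m)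
    ... | inj₂ x∈evo with ∈ₘ-Σₘ⁻ rhsA rs x∈evo
    ...   | evo _ _ _ , r∈ , x∈w = evolved r∈ x∈w
    ...   | into _ _ _ , _ , x∈∅ = ⊥-elim (∉ₘ-∅ x x∈∅)
    ...   | out _ _ _ , _ , x∈∅ = ⊥-elim (∉ₘ-∅ x x∈∅)
    ...   | div _ _ _ _ , _ , x∈∅ = ⊥-elim (∉ₘ-∅ x x∈∅)

  lhsLocal-object : ∀ (r : Rule nO nH) {x} → x ∈ₘ lhsLocal r → x ≡ ruleLhs r
  lhsLocal-object (evo _ o _) = ∈ₘ-single⁻ o _
  lhsLocal-object (out _ o _) = ∈ₘ-single⁻ o _
  lhsLocal-object (div _ o _ _) = ∈ₘ-single⁻ o _
  lhsLocal-object (into _ _ _) {x} x∈∅ = ⊥-elim (∉ₘ-∅ x x∈∅)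

  lhsParent-object : ∀ (r : Rule nO nH) {x} → x ∈ₘ lhsParent r → x ≡ ruleLhs r
  lhsParent-object (into _ o _) = ∈ₘ-single⁻ o _
  lhsParent-object (evo _ _ _) {x} x∈∅ = ⊥-elim (∉ₘ-∅ x x∈∅)
  lhsParent-object (out _ _ _) {x} x∈∅ = ⊥-elim (∉ₘ-∅ x x∈∅)
  lhsParent-object (div _ _ _ _) {x} x∈∅ = ⊥-elim (∉ₘ-∅ x x∈∅)

  main-result : ∀ h m rs cs → Σ (Multiset nO) λ m' →
                mem h m' (resultL cs) ∈ result (anode h m rs cs) × afterStep m rs cs ⊆ₘ m'
  main-result h m rs cs with divOf rs
  ... | nothing = _ , here refl , ⊆ₘ-refl {u = afterStep m rs cs}
  ... | just (u , _) = _ , here refl , ⊆ₘ-⊕ˡ (afterStep m rs cs) (single u)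

  occurs-result-below : ∀ {h m rs cs c d h₁ y} → c ∈ cs → d ∈ result c → Occurs d h₁ y →
                        Σ (Mem nO nH) λ d' → d' ∈ result (anode h m rs cs) × Occurs d' h₁ y
  occurs-result-below {h} {m} {rs} {cs} c∈ d∈ (p , label≡ , y∈) with main-result h m rs cs
  ... | _ , main∈ , _ = _ , main∈ , below (∈-resultL⁺ cs c∈ d∈) p , label≡ , y∈

  divOf-∈ : ∀ (rs : List (Rule nO nH)) {u v} → divOf rs ≡ just (u , v) → Σ (Fin nH) λ h → Σ (Fin nO) λ o → div h o u v ∈ rs
  divOf-∈ (div h o u v ∷ rs) refl = h , o , here refl
  divOf-∈ (evo _ _ _ ∷ rs) e = let (h , o , r∈) = divOf-∈ rs e in h , o , there r∈
  divOf-∈ (into _ _ _ ∷ rs) e = let (h , o , r∈) = divOf-∈ rs e in h , o , there r∈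
  divOf-∈ (out _ _ _ ∷ rs) e = let (h , o , r∈) = divOf-∈ rs e in h , o , there r∈

  memRule≤ : ∀ {r} (rs : List (Rule nO nH)) → r ∈ rs → memRule r ≤ sum (map memRule rs)
  memRule≤ (r ∷ rs) (here refl) = m≤m+n _ _
  memRule≤ (r ∷ rs) (there r∈) = ≤-trans (memRule≤ rs r∈) (m≤n+m _ _)

  divOf-unique : ∀ (rs : List (Rule nO nH)) {h o u v} → div h o u v ∈ rs → sum (map memRule rs) ≤ 1 →
                 divOf rs ≡ just (u , v)
  divOf-unique (_ ∷ rs) (here refl) _ = refl
  divOf-unique (evo _ _ _ ∷ rs) (there r∈) atMostOne = divOf-unique rs r∈ atMostOne
  divOf-unique (into _ _ _ ∷ rs) (there r∈) (s≤s none) = ⊥-elim (ℕₚ.1+n≰n (≤-trans (memRule≤ rs r∈) none))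
  divOf-unique (out _ _ _ ∷ rs) (there r∈) (s≤s none) = ⊥-elim (ℕₚ.1+n≰n (≤-trans (memRule≤ rs r∈) none))
  divOf-unique (div _ _ _ _ ∷ rs) (there r∈) (s≤s none) = ⊥-elim (ℕₚ.1+n≰n (≤-trans (memRule≤ rs r∈) none))

  DivProduct : List (Rule nO nH) → Fin nO → Set
  DivProduct rs x = Σ (Fin nO) λ u → Σ (Fin nO) λ v → divOf rs ≡ just (u , v) × (x ≡ u ⊎ x ≡ v)

  result-occurs⁻ : ∀ {h m rs cs d h₁ x} → d ∈ result (anode h m rs cs) → Occurs d h₁ x →
    (h₁ ≡ h × (x ∈ₘ afterStep m rs cs ⊎ DivProduct rs x)) ⊎
    (Σ (Mem nO nH) λ d' → d' ∈ resultL cs × Occurs d' h₁ x)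
  result-occurs⁻ {rs = rs} d∈ occ with divOf rs
  result-occurs⁻ (here refl) (top , refl , x∈) | nothing = inj₁ (refl , inj₁ x∈)
  result-occurs⁻ (here refl) (below d'∈ p , label≡ , x∈) | nothing = inj₂ (_ , d'∈ , p , label≡ , x∈)
  result-occurs⁻ {m = m} {rs} {cs} {x = x} (here refl) (top , refl , x∈) | just (u , v)
    with ∈ₘ-⊕⁻ (afterStep m rs cs) (single u) x∈
  ... | inj₁ x∈after = inj₁ (refl , inj₁ x∈after)
  ... | inj₂ x∈u = inj₁ (refl , inj₂ (u , v , refl , inj₁ (∈ₘ-single⁻ u x x∈u)))
  result-occurs⁻ {m = m} {rs} {cs} {x = x} (there (here refl)) (top , refl , x∈) | just (u , v)
    with ∈ₘ-⊕⁻ (afterStep m rs cs) (single v) x∈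
  ... | inj₁ x∈after = inj₁ (refl , inj₁ x∈after)
  ... | inj₂ x∈v = inj₁ (refl , inj₂ (u , v , refl , inj₂ (∈ₘ-single⁻ v x x∈v)))
  result-occurs⁻ (here refl) (below d'∈ p , label≡ , x∈) | just _ = inj₂ (_ , d'∈ , p , label≡ , x∈)
  result-occurs⁻ (there (here refl)) (below d'∈ p , label≡ , x∈) | just _ = inj₂ (_ , d'∈ , p , label≡ , x∈)

  module _ (m : Multiset nO) (rs : List (Rule nO nH)) (cs : List (ATree nO nH)) (available : consumed rs cs ⊆ₘ m) where

    available-local : ∀ {r x} → r ∈ rs → x ∈ₘ lhsLocal r → x ∈ₘ m
    available-local {r} {x} r∈ x∈ = begin
      1                                          ≤⟨ x∈ ⟩
      lookup (lhsLocal r) x                      ≤⟨ ⊆ₘ-Σₘ lhsLocal rs r∈ x ⟩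
      lookup (Σₘ (map lhsLocal rs)) x            ≤⟨ ⊆ₘ-⊕ˡ (Σₘ (map lhsLocal rs)) (childConsumption cs) x ⟩
      lookup (consumed rs cs) x                  ≤⟨ available x ⟩
      lookup m x                                 ∎
      where open ≤-Reasoning

    available-parent : ∀ {c r x} → c ∈ cs → r ∈ rulesOf c → x ∈ₘ lhsParent r → x ∈ₘ m
    available-parent {c} {r} {x} c∈ r∈ x∈ = begin
      1                                          ≤⟨ x∈ ⟩
      lookup (lhsParent r) x                     ≤⟨ ⊆ₘ-Σₘ lhsParent (rulesOf c) r∈ x ⟩
      lookup (Σₘ (map lhsParent (rulesOf c))) x  ≤⟨ ⊆ₘ-Σₘ (λ c → Σₘ (map lhsParent (rulesOf c))) cs c∈ x ⟩
      lookup (childConsumption cs) x             ≤⟨ ⊆ₘ-⊕ʳ (Σₘ (map lhsLocal rs)) (childConsumption cs) x ⟩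
      lookup (consumed rs cs) x                  ≤⟨ available x ⟩
      lookup m x                                 ∎
      where open ≤-Reasoning

module _ {nO nH : ℕ} where

  mutual
    clear-empty : ∀ (C : Mem nO nH) {h x} → ¬ Occurs (clear C) h x
    clear-empty (mem _ _ _) {x = x} (top , _ , x∈) = ∉ₘ-∅ x x∈
    clear-empty (mem _ _ cs) (below c∈ p , label≡ , x∈) = clearL-empty cs c∈ (p , label≡ , x∈)

    clearL-empty : ∀ (cs : List (Mem nO nH)) {c h x} → c ∈ clearL cs → ¬ Occurs c h x
    clearL-empty (c ∷ cs) (here refl) = clear-empty c
    clearL-empty (c ∷ cs) (there c∈) = clearL-empty cs c∈

  mutual
    isolate-occurs : ∀ (C : Mem nO nH) p o {h' m h x} → nodeAt C p ≡ just (h' , m) →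
                     Occurs (isolate C p o) h x → x ≡ o × h ≡ h'
    isolate-occurs (mem _ _ _) [] o refl (top , label≡ , x∈) = ∈ₘ-single⁻ o _ x∈ , sym label≡
    isolate-occurs (mem _ _ cs) [] o refl (below c∈ q , label≡ , x∈) = ⊥-elim (clearL-empty cs c∈ (q , label≡ , x∈))
    isolate-occurs (mem _ _ _) (k ∷ p) o {x = x} _ (top , _ , x∈) = ⊥-elim (∉ₘ-∅ x x∈)
    isolate-occurs (mem _ _ cs) (k ∷ p) o at≡ (below c∈ q , label≡ , x∈) = isolateL-occurs cs k p o at≡ c∈ (q , label≡ , x∈)

    isolateL-occurs : ∀ (cs : List (Mem nO nH)) k p o {h' m c h x} → nodeAtL cs k p ≡ just (h' , m) →
                      c ∈ isolateL cs k p o → Occurs c h x → x ≡ o × h ≡ h'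
    isolateL-occurs [] k p o () c∈ occ
    isolateL-occurs (c ∷ cs) zero p o at≡ (here refl) occ = isolate-occurs c p o at≡ occ
    isolateL-occurs (c ∷ cs) zero p o at≡ (there c∈) occ = ⊥-elim (clearL-empty cs c∈ occ)
    isolateL-occurs (c ∷ cs) (suc k) p o at≡ (here refl) occ = ⊥-elim (clear-empty c occ)
    isolateL-occurs (c ∷ cs) (suc k) p o at≡ (there c∈) occ = isolateL-occurs cs k p o at≡ c∈ occ

  mutual
    nodeAt-occurs : ∀ (C : Mem nO nH) p {h m o} → nodeAt C p ≡ just (h , m) → o ∈ₘ m → Occurs C h o
    nodeAt-occurs (mem _ _ _) [] refl o∈ = top , refl , o∈
    nodeAt-occurs (mem _ _ cs) (k ∷ p) at≡ o∈ with nodeAtL-occurs cs k p at≡ o∈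
    ... | c , c∈ , occ = occurs-below c∈ occ

    nodeAtL-occurs : ∀ (cs : List (Mem nO nH)) k p {h m o} → nodeAtL cs k p ≡ just (h , m) → o ∈ₘ m →
                     Σ (Mem nO nH) λ c → c ∈ cs × Occurs c h o
    nodeAtL-occurs [] k p () o∈
    nodeAtL-occurs (c ∷ cs) zero p at≡ o∈ = c , here refl , nodeAt-occurs c p at≡ o∈
    nodeAtL-occurs (c ∷ cs) (suc k) p at≡ o∈ with nodeAtL-occurs cs k p at≡ o∈
    ... | c' , c'∈ , occ = c' , there c'∈ , occ

module Productivity {nO nH : ℕ} (Π : System nO nH) where
  open System Π using (env; rules; initial; initialEnv; initialInj) renaming (yes to yesₒ)
  open Shape Π

  data Productive : Fin nH → Fin nO → Set where
    at-env   : Productive env yesₒ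
    via-evo  : ∀ {h x w y} → evo h x w ∈ rules → y ∈ₘ w → Productive h y → Productive h x
    via-out  : ∀ {h h' x u} → out h x u ∈ rules → Edge initial h h' → Productive h' u → Productive h x
    via-in   : ∀ {g h x u} → into g x u ∈ rules → Edge initial g h → Productive g u → Productive h x
    via-divˡ : ∀ {h x u v} → div h x u v ∈ rules → (∀ a → ¬ Edge initial a h) → h ≢ env →
               Productive h u → Productive h x
    via-divʳ : ∀ {h x u v} → div h x u v ∈ rules → (∀ a → ¬ Edge initial a h) → h ≢ env →
               Productive h v → Productive h x

  Source : ATree nO nH → Set
  Source T = Σ (Fin nH) λ h → Σ (Fin nO) λ x → Occurs (erase T) h x × Productive h x

  ParentSource : ATree nO nH → Set
  ParentSource (anode h _ rs _) =
    Σ (Fin nO) λ x → Σ (Fin nO) λ u → into h x u ∈ rs × into h x u ∈ rules × Productive h u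

  -- only the root carries the environment's label
  NotEnv : Bool → Fin nH → Set
  NotEnv true _ = ⊤
  NotEnv false h = h ≢ env

  module _ {b h m rs cs} (v : Valid rules b (anode h m rs cs)) (ws : WellShaped (mem h m (eraseL cs))) where

    private
      available : consumed rs cs ⊆ₘ m
      available = let (_ , _ , _ , _ , a , _) = v in a
      inR : All (_∈ rules) rs
      inR = let (i , _) = v in i
      labelled : All (λ r → ruleLabel r ≡ h) rs
      labelled = let (_ , l , _) = v in l
      vcs : ValidL rules cs
      vcs = let (_ , _ , _ , _ , _ , c) = v in c
      childEdge : ∀ {c} → c ∈ cs → Edge initial (labelOf (erase c)) h
      childEdge c∈ = proj₁ (proj₁ ws) (∈-map⁺ labelOf (∈-eraseL⁺ cs c∈))

    trace-out : ∀ {c h' o x} → c ∈ cs → out h' o x ∈ rulesOf c → Productive h x → Source (anode h m rs cs)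
    trace-out {anode g mc rsc csc} {o = o} c∈ r∈ px with validL-∈ cs vcs c∈
    ... | (inRc , labelledc , _ , _ , availablec , _) with All.lookup labelledc r∈
    ...   | refl = g , o ,
                   occurs-below (∈-eraseL⁺ cs c∈) (top , refl , available-local mc rsc csc availablec r∈ (∈ₘ-single o)) ,
                   via-out (All.lookup inRc r∈) (childEdge c∈) px

    trace-afterStep : ∀ {x} → x ∈ₘ afterStep m rs cs → Productive h x →
                      Source (anode h m rs cs) ⊎ ParentSource (anode h m rs cs)
    trace-afterStep x∈ px with provenance m rs cs x∈
    ... | untouched x∈m = inj₁ (h , _ , (top , refl , x∈m) , px)
    ... | sent-out c∈ r∈ = inj₁ (trace-out c∈ r∈ px)
    ... | evolved {o = o} r∈ x∈w with All.lookup labelled r∈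
    ...   | refl = inj₁ (h , o , (top , refl , available-local m rs cs available r∈ (∈ₘ-single o)) ,
                         via-evo (All.lookup inR r∈) x∈w px)
    trace-afterStep x∈ px | sent-in r∈ with All.lookup labelled r∈
    ...   | refl = inj₂ (_ , _ , r∈ , All.lookup inR r∈ , px)

    trace-division : NotEnv b h → ∀ {x} → DivProduct rs x → Productive h x → Source (anode h m rs cs)
    trace-division notEnv (u , w , div≡ , which) px with divOf-∈ rs div≡
    ... | _ , o , r∈ with All.lookup labelled r∈
    ...   | refl = h , o , (top , refl , available-local m rs cs available r∈ (∈ₘ-single o)) , productive which px
      where
      r∈R : div h o u w ∈ rules
      r∈R = All.lookup inR r∈
      elementary-label : ∀ a → ¬ Edge initial a h
      elementary-label a e with All.lookup (let (_ , _ , _ , el , _) = v in el) r∈ tt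
      ... | refl with proj₂ (proj₁ ws) e
      ...   | ()
      not-env : ∀ b → Valid rules b (anode h m rs cs) → NotEnv b h → h ≢ env
      not-env true (_ , _ , evos , _) _ = ⊥-elim (All.lookup evos r∈)
      not-env false _ h≢env = h≢env
      productive : ∀ {x} → (x ≡ u ⊎ x ≡ w) → Productive h x → Productive h o
      productive (inj₁ refl) = via-divˡ r∈R elementary-label (not-env b v notEnv)
      productive (inj₂ refl) = via-divʳ r∈R elementary-label (not-env b v notEnv)

    lift-source : ∀ {c} → c ∈ cs → Source c ⊎ ParentSource c → Source (anode h m rs cs)
    lift-source c∈ (inj₁ (h₁ , x , occ , px)) = h₁ , x , occurs-below (∈-eraseL⁺ cs c∈) occ , px
    lift-source {anode g _ _ _} c∈ (inj₂ (x , u , r∈ , r∈R , pu)) =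
      h , x , (top , refl , available-parent m rs cs available c∈ r∈ (∈ₘ-single x)) , via-in r∈R (childEdge c∈) pu

    children-not-env : ∀ {c} → c ∈ cs → labelOf (erase c) ≢ env
    children-not-env c∈ label≡env = edge-not-root initialInj (childEdge c∈) (trans label≡env (sym initialEnv))

  mutual
    trace : ∀ b (T : ATree nO nH) → Valid rules b T → WellShaped (erase T) → NotEnv b (labelOf (erase T)) →
            ∀ {d h₁ x} → d ∈ result T → Occurs d h₁ x → Productive h₁ x → Source T ⊎ ParentSource T
    trace b (anode h m rs cs) v ws notEnv d∈ occ px with result-occurs⁻ {h = h} {m = m} {rs = rs} {cs = cs} d∈ occ
    ... | inj₁ (refl , inj₁ x∈) = trace-afterStep {b} {h} {m} {rs} {cs} v ws x∈ px
    ... | inj₁ (refl , inj₂ dp) = inj₁ (trace-division {b} {h} {m} {rs} {cs} v ws notEnv dp px)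
    ... | inj₂ (d' , d'∈ , occ') with traceL cs (let (_ , _ , _ , _ , _ , vcs) = v in vcs) (proj₂ ws)
                                        (children-not-env {b} {h} {m} {rs} {cs} v ws) d'∈ occ' px
    ...   | c , c∈ , src = inj₁ (lift-source {b} {h} {m} {rs} {cs} v ws c∈ src)

    traceL : ∀ (cs : List (ATree nO nH)) → ValidL rules cs → WellShapedL (eraseL cs) →
             (∀ {c} → c ∈ cs → labelOf (erase c) ≢ env) →
             ∀ {d h₁ x} → d ∈ resultL cs → Occurs d h₁ x → Productive h₁ x →
             Σ (ATree nO nH) λ c → c ∈ cs × (Source c ⊎ ParentSource c)
    traceL (c ∷ cs) (vc , vcs) (wc , wcs) notEnv d∈ occ px with ∈-++⁻ (result c) d∈
    ... | inj₁ d∈c = c , here refl , trace false c vc wc (notEnv (here refl)) d∈c occ px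
    ... | inj₂ d∈cs with traceL cs vcs wcs (λ c∈ → notEnv (there c∈)) d∈cs occ px
    ...   | c' , c'∈ , src = c' , there c'∈ , src

  trace-run : ∀ {C t D} → Reach rules C t D → Invariant C → yesₒ ∈ₘ envContent D →
              Σ (Fin nH) λ h → Σ (Fin nO) λ x → Occurs C h x × Productive h x
  trace-run (step {C₁ = C₁} st@(T , refl , v , _ , _ , result≡) run) inv yes∈
    with trace-run run (invariant-step st inv) yes∈
  ... | h₁ , x , occ , px with trace true T v (proj₂ inv) tt (subst (C₁ ∈_) (sym result≡) (here refl)) occ px
  ...   | inj₁ src = src
  ...   | inj₂ src = ⊥-elim (no-parent T v src)
    where
    -- the environment has no parent to take objects from
    no-parent : ∀ T → Valid rules true T → ¬ ParentSource T
    no-parent (anode _ _ _ _) (_ , _ , evos , _) (_ , _ , r∈ , _) = All.lookup evos r∈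
  trace-run {mem h m cs} done (root≡ , _) yes∈ = env , yesₒ , (top , root≡ , yes∈) , at-env

module _ {nO nH : ℕ} where

  mutual
    single-at : (C : Mem nO nH) → Position C → Rule nO nH → ATree nO nH
    single-at (mem h m cs) top r = anode h m (r ∷ []) (bareL cs)
    single-at (mem h m cs) (below c∈ p) r = anode h m [] (single-atL cs c∈ p r)

    single-atL : (cs : List (Mem nO nH)) → ∀ {c} → c ∈ cs → Position c → Rule nO nH → List (ATree nO nH)
    single-atL (c ∷ cs) (here refl) p r = single-at c p r ∷ bareL cs
    single-atL (c ∷ cs) (there c∈) p r = bare c ∷ single-atL cs c∈ p r

  mutual
    erase-single-at : ∀ (C : Mem nO nH) p r → erase (single-at C p r) ≡ C
    erase-single-at (mem h m cs) top r = cong (mem h m) (eraseL-bareL cs)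
    erase-single-at (mem h m cs) (below c∈ p) r = cong (mem h m) (eraseL-single-atL cs c∈ p r)

    eraseL-single-atL : ∀ (cs : List (Mem nO nH)) {c} (c∈ : c ∈ cs) p r → eraseL (single-atL cs c∈ p r) ≡ cs
    eraseL-single-atL (c ∷ cs) (here refl) p r = cong₂ _∷_ (erase-single-at c p r) (eraseL-bareL cs)
    eraseL-single-atL (c ∷ cs) (there c∈) p r = cong₂ _∷_ (erase-bare c) (eraseL-single-atL cs c∈ p r)

  mutual
    ruleCount-single-at : ∀ (C : Mem nO nH) p r → ruleCount (single-at C p r) ≡ 1
    ruleCount-single-at (mem h m cs) top r = cong suc (ruleCountL-bareL cs)
    ruleCount-single-at (mem h m cs) (below c∈ p) r = ruleCountL-single-atL cs c∈ p r

    ruleCountL-single-atL : ∀ (cs : List (Mem nO nH)) {c} (c∈ : c ∈ cs) p r → ruleCountL (single-atL cs c∈ p r) ≡ 1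
    ruleCountL-single-atL (c ∷ cs) (here refl) p r = cong₂ _+_ (ruleCount-single-at c p r) (ruleCountL-bareL cs)
    ruleCountL-single-atL (c ∷ cs) (there c∈) p r = cong₂ _+_ (ruleCount-bare c) (ruleCountL-single-atL cs c∈ p r)

  rootFlag : ∀ {C : Mem nO nH} → Position C → Bool → Bool
  rootFlag top b = b
  rootFlag (below _ _) _ = false

  rootFlag-false : ∀ {C : Mem nO nH} (p : Position C) → rootFlag p false ≡ false
  rootFlag-false top = refl
  rootFlag-false (below _ _) = refl

  ParentSupplies : (C : Mem nO nH) → Position C → Rule nO nH → Set
  ParentSupplies C top r = ⊤
  ParentSupplies (mem h m cs) (below c∈ top) r = lhsParent r ⊆ₘ m
  ParentSupplies (mem h m cs) (below {c = c} c∈ (below c'∈ p)) r = ParentSupplies c (below c'∈ p) r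

  supplies-nothing : ∀ (C : Mem nO nH) (p : Position C) r → lhsParent r ≡ ∅ₘ → ParentSupplies C p r
  supplies-nothing C top r _ = tt
  supplies-nothing (mem h m cs) (below c∈ top) r ∅≡ = subst (_⊆ₘ m) (sym ∅≡) (∅-⊆ₘ m)
  supplies-nothing (mem h m cs) (below {c = c} c∈ (below c'∈ p)) r ∅≡ = supplies-nothing c (below c'∈ p) r ∅≡

  extend : ∀ {C : Mem nO nH} (p : Position C) {d} → d ∈ children (at p) → Position C
  extend {mem _ _ _} top d∈ = below d∈ top
  extend (below c∈ p) d∈ = below c∈ (extend p d∈)

  at-extend : ∀ {C : Mem nO nH} (p : Position C) {d} (d∈ : d ∈ children (at p)) → at (extend p d∈) ≡ d
  at-extend {mem _ _ _} top d∈ = refl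
  at-extend (below c∈ p) d∈ = at-extend p d∈

  rootFlag-extend : ∀ {C : Mem nO nH} (p : Position C) {d} (d∈ : d ∈ children (at p)) b → rootFlag (extend p d∈) b ≡ false
  rootFlag-extend {mem _ _ _} top d∈ b = refl
  rootFlag-extend (below c∈ p) d∈ b = refl

  supplies-extend : ∀ (C : Mem nO nH) (p : Position C) {d} (d∈ : d ∈ children (at p)) r →
                    lhsParent r ⊆ₘ content (at p) → ParentSupplies C (extend p d∈) r
  supplies-extend (mem h m cs) top d∈ r supplied = supplied
  supplies-extend (mem h m cs) (below {c = mem _ _ _} c∈ top) d∈ r supplied = supplied
  supplies-extend (mem h m cs) (below {c = mem hc mc csc} c∈ (below c'∈ p)) d∈ r supplied =
    supplies-extend (mem hc mc csc) (below c'∈ p) d∈ r supplied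

  childConsumption-bareL : ∀ (cs : List (Mem nO nH)) j → lookup (childConsumption (bareL cs)) j ≡ 0
  childConsumption-bareL [] j = lookup-∅ j
  childConsumption-bareL (mem _ _ _ ∷ cs) j =
    trans (lookup-⊕-zeroˡ ∅ₘ (childConsumption (bareL cs)) j (lookup-∅ j)) (childConsumption-bareL cs j)

  childConsumption-single-atL : ∀ (cs : List (Mem nO nH)) {c} (c∈ : c ∈ cs) p r j →
    lookup (childConsumption (single-atL cs c∈ p r)) j ≡ lookup (Σₘ (map lhsParent (rulesOf (single-at c p r)))) j
  childConsumption-single-atL (c ∷ cs) (here refl) p r j =
    lookup-⊕-zeroʳ (Σₘ (map lhsParent (rulesOf (single-at c p r)))) _ j (childConsumption-bareL cs j)
  childConsumption-single-atL (mem _ _ _ ∷ cs) (there c∈) p r j =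
    trans (lookup-⊕-zeroˡ ∅ₘ _ j (lookup-∅ j)) (childConsumption-single-atL cs c∈ p r j)

  subjectCond-[] : ∀ b → SubjectCond {nO} {nH} b []
  subjectCond-[] true = []
  subjectCond-[] false = z≤n

module _ {nO nH : ℕ} (R : List (Rule nO nH)) where

  Applicable : Bool → Mem nO nH → Rule nO nH → Set
  Applicable b N r = r ∈ R × ruleLabel r ≡ labelOf N × SubjectCond b (r ∷ []) ×
                     (IsDiv r → children N ≡ []) × lhsLocal r ⊆ₘ content N

  mutual
    valid-bare : ∀ b (C : Mem nO nH) → Valid R b (bare C)
    valid-bare b (mem h m cs) =
      [] , [] , subjectCond-[] b , [] ,
      (λ j → subst (_≤ lookup m j) (sym (trans (lookup-⊕-zeroˡ ∅ₘ (childConsumption (bareL cs)) j (lookup-∅ j))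
                                             (childConsumption-bareL cs j))) z≤n) ,
      valid-bareL cs

    valid-bareL : ∀ (cs : List (Mem nO nH)) → ValidL R (bareL cs)
    valid-bareL [] = tt
    valid-bareL (c ∷ cs) = valid-bare false c , valid-bareL cs

  mutual
    valid-single-at : ∀ b (C : Mem nO nH) (p : Position C) r →
                      Applicable (rootFlag p b) (at p) r → ParentSupplies C p r → Valid R b (single-at C p r)
    valid-single-at b (mem h m cs) top r (r∈ , label≡ , subject , elementary , local⊆) _ =
      (r∈ ∷ []) , (label≡ ∷ []) , subject , ((λ isDiv → cong bareL (elementary isDiv)) ∷ []) ,
      (λ j → subst (_≤ lookup m j)
         (sym (trans (lookup-⊕-zeroʳ (Σₘ (map lhsLocal (r ∷ []))) (childConsumption (bareL cs)) j
                       (childConsumption-bareL cs j)) (Σₘ-single lhsLocal r j)))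
         (local⊆ j)) ,
      valid-bareL cs
    valid-single-at b (mem h m cs) (below {c = mem hc mc csc} c∈ p) r applicable supplies =
      [] , [] , subjectCond-[] b , [] ,
      (λ j → subst (_≤ lookup m j)
         (sym (trans (lookup-⊕-zeroˡ ∅ₘ (childConsumption (single-atL cs c∈ p r)) j (lookup-∅ j))
                     (childConsumption-single-atL cs c∈ p r j)))
         (parent-demand p supplies j)) ,
      valid-single-atL cs c∈ p r applicable′ (supplies′ p supplies)
      where
      applicable′ : Applicable (rootFlag p false) (at p) r
      applicable′ = subst (λ b → Applicable b (at p) r) (sym (rootFlag-false p)) applicable
      parent-demand : ∀ (p : Position (mem hc mc csc)) → ParentSupplies (mem h m cs) (below c∈ p) r →
                      Σₘ (map lhsParent (rulesOf (single-at (mem hc mc csc) p r))) ⊆ₘ m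
      parent-demand top supplies j = subst (_≤ lookup m j) (sym (Σₘ-single lhsParent r j)) (supplies j)
      parent-demand (below _ _) _ j = subst (_≤ lookup m j) (sym (lookup-∅ j)) z≤n
      supplies′ : ∀ (p : Position (mem hc mc csc)) → ParentSupplies (mem h m cs) (below c∈ p) r →
                  ParentSupplies (mem hc mc csc) p r
      supplies′ top _ = tt
      supplies′ (below _ _) supplies = supplies

    valid-single-atL : ∀ (cs : List (Mem nO nH)) {c} (c∈ : c ∈ cs) p r →
                       Applicable (rootFlag p false) (at p) r → ParentSupplies c p r → ValidL R (single-atL cs c∈ p r)
    valid-single-atL (c ∷ cs) (here refl) p r applicable supplies = valid-single-at false c p r applicable supplies , valid-bareL cs
    valid-single-atL (c ∷ cs) (there c∈) p r applicable supplies = valid-bare false c , valid-single-atL cs c∈ p r applicable supplies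

module _ {nO nH : ℕ} where

  data AppliedAt (r : Rule nO nH) : ATree nO nH → Set where
    at-root  : ∀ {h m rs cs} → r ∈ rs → AppliedAt r (anode h m rs cs)
    at-child : ∀ {h m rs cs c} → c ∈ cs → AppliedAt r c → AppliedAt r (anode h m rs cs)

  AppliedBelow : Rule nO nH → ATree nO nH → Set
  AppliedBelow r (anode _ _ _ cs) = Σ (ATree nO nH) λ c → c ∈ cs × AppliedAt r c

  ⊏ₗ-child : ∀ {c} {cs cs' : List (ATree nO nH)} → c ∈ cs → cs ⊏ₗ cs' →
             (Σ (ATree nO nH) λ c' → c' ∈ cs' × c ⊏ c') ⊎ c ∈ cs'
  ⊏ₗ-child (here refl) (hd p) = inj₁ (_ , here refl , p)
  ⊏ₗ-child (here refl) (tl p) = inj₂ (here refl)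
  ⊏ₗ-child (there c∈) (hd p) = inj₂ (there c∈)
  ⊏ₗ-child (there c∈) (tl p) with ⊏ₗ-child c∈ p
  ... | inj₁ (c' , c'∈ , c⊏c') = inj₁ (c' , there c'∈ , c⊏c')
  ... | inj₂ c∈′ = inj₂ (there c∈′)

  applied-⊏ : ∀ {r} {T T' : ATree nO nH} → T ⊏ T' → AppliedAt r T → AppliedAt r T'
  applied-⊏ (here _) (at-root r∈) = at-root (there r∈)
  applied-⊏ (there _) (at-root r∈) = at-root r∈
  applied-⊏ (here _) (at-child c∈ a) = at-child c∈ a
  applied-⊏ (there p) (at-child c∈ a) with ⊏ₗ-child c∈ p
  ... | inj₁ (c' , c'∈ , c⊏c') = at-child c'∈ (applied-⊏ c⊏c' a)
  ... | inj₂ c∈′ = at-child c∈′ a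

  applied-⊏* : ∀ {r} {T T' : ATree nO nH} → T ⊏* T' → AppliedAt r T → AppliedAt r T'
  applied-⊏* ε a = a
  applied-⊏* (p ◅ ps) a = applied-⊏* ps (applied-⊏ p a)

  appliedBelow-⊏* : ∀ {r} {T T' : ATree nO nH} → T ⊏* T' → AppliedBelow r T → AppliedBelow r T'
  appliedBelow-⊏* ε a = a
  appliedBelow-⊏* (here _ ◅ ps) a = appliedBelow-⊏* ps a
  appliedBelow-⊏* (there p ◅ ps) (c , c∈ , a) with ⊏ₗ-child c∈ p
  ... | inj₁ (c' , c'∈ , c⊏c') = appliedBelow-⊏* ps (c' , c'∈ , applied-⊏ c⊏c' a)
  ... | inj₂ c∈′ = appliedBelow-⊏* ps (c , c∈′ , a)

  mutual
    applied-single-at : ∀ (C : Mem nO nH) p r → AppliedAt r (single-at C p r)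
    applied-single-at (mem h m cs) top r = at-root (here refl)
    applied-single-at (mem h m cs) (below {c = c} c∈ p) r = at-child (∈-single-atL cs c∈ p r) (applied-single-at c p r)

    ∈-single-atL : ∀ (cs : List (Mem nO nH)) {c} (c∈ : c ∈ cs) p r → single-at c p r ∈ single-atL cs c∈ p r
    ∈-single-atL (c ∷ cs) (here refl) p r = here refl
    ∈-single-atL (c ∷ cs) (there c∈) p r = there (∈-single-atL cs c∈ p r)

  appliedBelow-single-at : ∀ h m cs {c} (c∈ : c ∈ cs) (p : Position c) r → AppliedBelow r (single-at (mem h m cs) (below c∈ p) r)
  appliedBelow-single-at h m cs c∈ p r = _ , ∈-single-atL cs c∈ p r , applied-single-at _ p r

  products-appear : ∀ {R b r x} (T : ATree nO nH) → Valid R b T → AppliedAt r T → x ∈ₘ rhsA r ⊕ rhsIn r →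
                    Σ (Mem nO nH) λ d → d ∈ result T × Occurs d (ruleLabel r) x
  products-appear {r = r} {x} (anode h m rs cs) (_ , labelled , _) (at-root r∈) x∈
    with All.lookup labelled r∈ | main-result h m rs cs
  ... | refl | _ , main∈ , after⊆ = _ , main∈ , top , refl , ≤-trans (made x∈) (after⊆ x)
    where
    made : x ∈ₘ rhsA r ⊕ rhsIn r → x ∈ₘ afterStep m rs cs
    made x∈ with ∈ₘ-⊕⁻ (rhsA r) (rhsIn r) x∈
    ... | inj₁ x∈a = ≤-trans x∈a (≤-trans (⊆ₘ-Σₘ rhsA rs r∈ x) (fromEvo-⊆ₘ m rs cs x))
    ... | inj₂ x∈b = ≤-trans x∈b (≤-trans (⊆ₘ-Σₘ rhsIn rs r∈ x) (fromParent-⊆ₘ m rs cs x))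
  products-appear {x = x} (anode h m rs cs) (_ , _ , _ , _ , _ , vcs) (at-child c∈ a) x∈
    with products-appear _ (validL-∈ cs vcs c∈) a x∈
  ... | d , d∈ , occ = occurs-result-below {m = m} {rs} c∈ d∈ occ

  out-product-appears : ∀ {R b h o u} (T : ATree nO nH) → Valid R b T → AppliedBelow (out h o u) T →
                        Σ (Fin nH) λ h' → Edge (erase T) h h' × Σ (Mem nO nH) λ d → d ∈ result T × Occurs d h' u
  out-product-appears (anode _ _ _ _) v (c , c∈ , a) = out-from-child v c∈ a
    where
    out-from-child : ∀ {R b h o u h' m rs cs c} → Valid R b (anode h' m rs cs) → c ∈ cs → AppliedAt (out h o u) c →
                     Σ (Fin nH) λ h'' → Edge (mem h' m (eraseL cs)) h h'' ×
                       Σ (Mem nO nH) λ d → d ∈ result (anode h' m rs cs) × Occurs d h'' u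
    out-from-child {u = u} {h'} {m} {rs} {cs} {anode g mc rsc csc} (_ , _ , _ , _ , _ , vcs) c∈ (at-root r∈)
      with validL-∈ cs vcs c∈ | main-result h' m rs cs
    ... | (_ , labelledc , _) | _ , main∈ , after⊆ with All.lookup labelledc r∈
    ...   | refl = h' , edge-top (∈-map⁺ labelOf (∈-eraseL⁺ cs c∈)) , _ , main∈ , top , refl ,
                   ≤-trans (∈ₘ-single u) (≤-trans (⊆ₘ-Σₘ rhsOut rsc r∈ u)
                     (≤-trans (⊆ₘ-Σₘ (λ c → Σₘ (map rhsOut (rulesOf c))) cs c∈ u)
                       (≤-trans (fromChildren-⊆ₘ m rs cs u) (after⊆ u))))
    out-from-child {m = m} {rs} {cs} {anode _ _ _ _} (_ , _ , _ , _ , _ , vcs) c∈ (at-child c'∈ a)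
      with out-from-child (validL-∈ cs vcs c∈) c'∈ a
    ... | h'' , e , d , d∈ , occ = h'' , edge-below (∈-eraseL⁺ cs c∈) e , occurs-result-below {m = m} {rs} c∈ d∈ occ

  div-products-appear : ∀ {R b h o u v} (T : ATree nO nH) → Valid R b T → AppliedAt (div h o u v) T →
                        (Σ (Mem nO nH) λ d → d ∈ result T × Occurs d h u) × (Σ (Mem nO nH) λ d → d ∈ result T × Occurs d h v)
  div-products-appear {b = true} (anode _ _ _ _) (_ , _ , evos , _) (at-root r∈) = ⊥-elim (All.lookup evos r∈)
  div-products-appear {b = false} {u = u} {v} (anode h m rs cs) (_ , labelled , atMostOne , _) (at-root r∈)
    with All.lookup labelled r∈ | divOf rs | divOf-unique rs r∈ atMostOne
  ... | refl | .(just (u , v)) | refl =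
    (_ , here refl , top , refl , ≤-trans (∈ₘ-single u) (⊆ₘ-⊕ʳ (afterStep m rs cs) (single u) u)) ,
    (_ , there (here refl) , top , refl , ≤-trans (∈ₘ-single v) (⊆ₘ-⊕ʳ (afterStep m rs cs) (single v) v))
  div-products-appear (anode h m rs cs) (_ , _ , _ , _ , _ , vcs) (at-child c∈ a)
    with div-products-appear _ (validL-∈ cs vcs c∈) a
  ... | (d , d∈ , occ) , (d' , d'∈ , occ') =
    occurs-result-below {m = m} {rs} c∈ d∈ occ , occurs-result-below {m = m} {rs} c∈ d'∈ occ'

module Forward {nO nH : ℕ} (Π : System nO nH) where
  open System Π using (env; rules; initial; initialEnv; initialInj; noRuleYes) renaming (yes to yesₒ)
  open Shape Π
  open Productivity Π

  YesRun : Mem nO nH → Set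
  YesRun C = Σ ℕ λ s → Σ (Mem nO nH) λ E → Reach rules C s E × Halted rules E × yesₒ ∈ₘ envContent E

  -- No rule consumes yes, so once in the environment it stays there.
  yes-not-consumed : ∀ {h m rs cs} → Valid rules true (anode h m rs cs) → ¬ (yesₒ ∈ₘ consumed rs cs)
  yes-not-consumed {rs = rs} {cs} (inR , _ , _ , _ , _ , vcs) yes∈
    with ∈ₘ-⊕⁻ (Σₘ (map lhsLocal rs)) (childConsumption cs) yes∈
  ... | inj₁ yes∈local with ∈ₘ-Σₘ⁻ lhsLocal rs yes∈local
  ...   | r , r∈ , yes∈r = All.lookup noRuleYes (All.lookup inR r∈) (sym (lhsLocal-object r yes∈r))
  yes-not-consumed {rs = rs} {cs} (_ , _ , _ , _ , _ , vcs) yes∈ | inj₂ yes∈children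
    with ∈ₘ-Σₘ⁻ (λ c → Σₘ (map lhsParent (rulesOf c))) cs yes∈children
  ... | anode _ _ rsc _ , c∈ , yes∈c with ∈ₘ-Σₘ⁻ lhsParent rsc yes∈c | validL-∈ cs vcs c∈
  ...   | r , r∈ , yes∈r | (inRc , _) = All.lookup noRuleYes (All.lookup inRc r∈) (sym (lhsParent-object r yes∈r))

  yes-stays : ∀ {C C'} → Step rules C C' → yesₒ ∈ₘ envContent C → yesₒ ∈ₘ envContent C'
  yes-stays (anode h m rs cs , refl , v@(_ , _ , evos , _) , _ , _ , result≡) yes∈
    with divOf rs | divOf-evo rs evos
  ... | nothing | refl with result≡
  ...   | refl = ≤-trans (∈ₘ-⊖⁺ m (consumed rs cs) yes∈ (yes-not-consumed {h} {m} {rs} {cs} v))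
                       (leftover-⊆ₘ m rs cs yesₒ)

  fire : ∀ C (p : Position C) r {h y} →
         Applicable rules (rootFlag p true) (at p) r → ParentSupplies C p r →
         (∀ T → single-at C p r ⊏* T → Valid rules true T → Σ (Mem nO nH) λ d → d ∈ result T × Occurs d h y) →
         (∀ C' → Invariant C' → Occurs C' h y → AllHalt rules C' → YesRun C') →
         Invariant C → AllHalt rules C → YesRun C
  fire C p r applicable supplies lands k inv (acc rest)
    with step-above rules C (single-at C p r) (erase-single-at C p r)
           (≤-reflexive (sym (ruleCount-single-at C p r))) (valid-single-at rules true C p r applicable supplies)
  ... | record { tree = T ; extends = ext ; valid = v ; result≡ = result≡ ; stepped = st }
    with lands T ext v
  ...   | d , d∈ , occ with subst (d ∈_) result≡ d∈
  ...     | here refl with k _ (invariant-step st inv) occ (rest st)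
  ...       | s , E , run , halted , yes∈ = suc s , E , step st run , halted , yes∈

  subject-evo : ∀ b {h x w} → SubjectCond {nO} {nH} b (evo h x w ∷ [])
  subject-evo true = tt ∷ []
  subject-evo false = z≤n

  mutual
    forward : ∀ {h x} → Productive h x → ∀ C → Invariant C → Occurs C h x → AllHalt rules C → YesRun C
    forward at-env C@(mem _ _ _) inv (top , _ , yes∈) halts =
      halting-run rules (λ E → yesₒ ∈ₘ envContent E) yes-stays C halts yes∈
    forward at-env (mem h m cs) (_ , w) (below c∈ p , label≡ , _) _ =
      ⊥-elim (below-not-env {h} {m} {cs} w c∈ p label≡)
    forward (via-evo {h} {x} {w} {y} r∈ y∈w py) C inv (p , label≡ , x∈) =
      fire C p (evo h x w)
        (r∈ , sym label≡ , subject-evo (rootFlag p true) , (λ ()) , single-⊆ₘ (content (at p)) x∈)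
        (supplies-nothing C p _ refl)
        (λ T ext v → products-appear T v (applied-⊏* ext (applied-single-at C p _)) (≤-trans y∈w (⊆ₘ-⊕ˡ w ∅ₘ y)))
        (forward py) inv
    forward (via-out r∈ e pu) (mem _ _ _) (root≡ , _) (top , label≡ , _) _ =
      ⊥-elim (edge-not-root initialInj e (trans (sym label≡) (trans root≡ (sym initialEnv))))
    forward (via-out {h} {h'} {x} {u} r∈ e pu) C@(mem hC mC cs) inv@(_ , w) (below c∈ p , label≡ , x∈) =
      fire C (below c∈ p) (out h x u) (r∈ , sym label≡ , s≤s z≤n , (λ ()) , single-⊆ₘ (content (at p)) x∈)
        (supplies-nothing C (below c∈ p) _ refl) lands (forward pu) inv
      where
      erased-to-C : ∀ {T} → single-at C (below c∈ p) (out h x u) ⊏* T → erase T ≡ C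
      erased-to-C ext = trans (⊏*-erase ext) (erase-single-at C (below c∈ p) (out h x u))
      lands : ∀ T → single-at C (below c∈ p) (out h x u) ⊏* T → Valid rules true T →
              Σ (Mem nO nH) λ d → d ∈ result T × Occurs d h' u
      lands T ext v with out-product-appears T v (appliedBelow-⊏* ext (appliedBelow-single-at hC mC cs c∈ p _))
      ... | h'' , e' , found with edge-functional initialInj e
                                    (edge-initial w (subst (λ D → Edge D h h'') (erased-to-C ext) e'))
      ...   | refl = found
    forward (via-in {g} {h} {x} {u} r∈ e pu) C inv@(_ , w) (p , label≡ , x∈) halts
      with child-labelled (at p) (wellShaped-at p w) (subst (Edge initial g) (sym label≡) e)
    ... | d , d∈ , d-label =
      fire C (extend p d∈) (into g x u)
        (r∈ , trans (sym d-label) (cong labelOf (sym (at-extend p d∈))) ,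
         subst (λ b → SubjectCond b (into g x u ∷ [])) (sym (rootFlag-extend p d∈ true)) (s≤s z≤n) ,
         (λ ()) , ∅-⊆ₘ (content (at (extend p d∈))))
        (supplies-extend C p d∈ _ (single-⊆ₘ (content (at p)) x∈))
        (λ T ext v → products-appear T v (applied-⊏* ext (applied-single-at C _ _))
                       (≤-trans (∈ₘ-single u) (⊆ₘ-⊕ʳ ∅ₘ (single u) u)))
        (forward pu) inv halts
    forward (via-divˡ r∈ no-child h≢env pu) C inv occ = forward-div r∈ no-child h≢env (inj₁ refl) pu C inv occ
    forward (via-divʳ r∈ no-child h≢env pv) C inv occ = forward-div r∈ no-child h≢env (inj₂ refl) pv C inv occ

    forward-div : ∀ {h x u v z} → div h x u v ∈ rules → (∀ a → ¬ Edge initial a h) → h ≢ env → (z ≡ u ⊎ z ≡ v) →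
                  Productive h z → ∀ C → Invariant C → Occurs C h x → AllHalt rules C → YesRun C
    forward-div r∈ no-child h≢env z≡ pz (mem _ _ _) (root≡ , _) (top , label≡ , _) _ =
      ⊥-elim (h≢env (trans (sym label≡) root≡))
    forward-div {h} {x} {u} {v} r∈ no-child h≢env z≡ pz C@(mem _ _ _) inv@(_ , w) (below c∈ p , label≡ , x∈) =
      fire C (below c∈ p) (div h x u v)
        (r∈ , sym label≡ , s≤s z≤n ,
         (λ (_ : IsDiv (div h x u v)) → elementary (at p) (wellShaped-at {C} (below c∈ p) w)
                                          (subst (λ b → ∀ a → ¬ Edge initial a b) (sym label≡) no-child)) ,
         single-⊆ₘ (content (at p)) x∈)
        (supplies-nothing C (below c∈ p) _ refl)
        (λ T ext vT → copy {T} z≡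
           (div-products-appear T vT (applied-⊏* ext (applied-single-at C (below c∈ p) (div h x u v)))))
        (forward pz) inv
      where
      copy : ∀ {T z} → (z ≡ u ⊎ z ≡ v) →
             (Σ (Mem nO nH) λ d → d ∈ result T × Occurs d h u) × (Σ (Mem nO nH) λ d → d ∈ result T × Occurs d h v) →
             Σ (Mem nO nH) λ d → d ∈ result T × Occurs d h z
      copy (inj₁ refl) (found , _) = found
      copy (inj₂ refl) (_ , found) = found

all-halt : ∀ {nO nH} (Π : System nO nH) → IsRecogniser Π ⊎ IsRecogniser≥1 Π ⊎ IsAcknowledger Π →
           AllHalt (System.rules Π) (System.initial Π)
all-halt Π (inj₁ recogniser) = proj₁ recogniser
all-halt Π (inj₂ (inj₁ recogniser≥1)) = proj₁ recogniser≥1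
all-halt Π (inj₂ (inj₂ acknowledger)) = acknowledger

all-halt-reach : ∀ {nO nH} {R : List (Rule nO nH)} {C t C'} → Reach R C t C' → AllHalt R C → AllHalt R C'
all-halt-reach done halts = halts
all-halt-reach (step st run) (acc rest) = all-halt-reach run (rest st)

isolated-productive : ∀ {nO nH} (Π : System nO nH) {C p h m o t D} →
  Reach (System.rules Π) (isolate C p o) t D → Shape.Invariant Π C → nodeAt C p ≡ just (h , m) →
  1 ≤ countEnv Π D (System.yes Π) → Productivity.Productive Π h o
isolated-productive Π {C} {p} {o = o} run inv at≡ yes∈
  with Productivity.trace-run Π run (Shape.invariant-isolate Π C p o inv) yes∈
... | _ , _ , occ , productive with isolate-occurs C p o at≡ occ
...   | refl , refl = productive

lemma13 : ∀ {nO nH} (Π : System nO nH) →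
    IsRecogniser Π ⊎ IsRecogniser≥1 Π ⊎ IsAcknowledger Π →
    ∀ (i : ℕ) (Cᵢ : Mem nO nH) → Reach (System.rules Π) (System.initial Π) i Cᵢ →
    ∀ (p : List ℕ) (h : Fin nH) (m : Multiset nO) (o : Fin nO) →
    nodeAt Cᵢ p ≡ just (h , m) → 1 ≤ lookup m o →
    ∀ (t : ℕ) (D : Mem nO nH) →
    Reach (System.rules Π) (isolate Cᵢ p o) t D →
    Halted (System.rules Π) D → 1 ≤ countEnv Π D (System.yes Π) →
    Σ ℕ λ s → Σ (Mem nO nH) λ E →
      Reach (System.rules Π) Cᵢ s E × Halted (System.rules Π) E ×
      1 ≤ countEnv Π E (System.yes Π)
lemma13 Π kind i Cᵢ reachᵢ p h m o at≡ o∈ t D run _ yes∈ =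
  forward (isolated-productive Π run invariantᵢ at≡ yes∈) Cᵢ invariantᵢ (nodeAt-occurs Cᵢ p at≡ o∈)
    (all-halt-reach reachᵢ (all-halt Π kind))
  where
  open Shape Π using (Invariant; invariant-reach; invariant-initial)
  open Forward Π using (forward)
  invariantᵢ : Invariant Cᵢ
  invariantᵢ = invariant-reach reachᵢ invariant-initial
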